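{- Let $\mathcal{C}$ be a self-dual code of length $n$ over $\mathbb{Z}_{2^m}$ and let $\mathcal{C}_0$ be a proper subcode of index $2$ in $\mathcal{C}$. Write $\mathcal{C}=\mathcal{C}_0\cup\mathcal{C}_2$ and $\mathcal{C}_0^{\perp}=\mathcal{C}_0\cup\mathcal{C}_2\cup\mathcal{C}_1\cup\mathcal{C}_3$, where $\mathcal{C}_2=t+\mathcal{C}_0$, $\mathcal{C}_1=s+\mathcal{C}_0$ and $\mathcal{C}_3=s+t+\mathcal{C}_0$ for some $t\in\mathcal{C}\setminus\mathcal{C}_0$ and $s\in\mathcal{C}_0^{\perp}\setminus\mathcal{C}$. Let $k\geq 1$ and suppose $v_1,v_2\in\mathbb{Z}_{2^m}^k$ satisfy: (P1) if $\alpha,\beta\in\mathbb{Z}_{2^m}$ with $0\leq\alpha<o(v_1)$, $0\leq\beta<o(v_2)$ and $\alpha v_1+\beta v_2=0$, then $\alpha=\beta=0$; (P2) $v_1\cdot v_1\equiv -s\cdot s$, $v_1\cdot v_2\equiv -t\cdot s$ and $v_2\cdot v_2\equiv -t\cdot t \pmod{2^m}$; (P3) if $m\geq 2$: $o(v_1)\equiv 0 \pmod 2$ when $\mathcal{C}_0^{\perp}/\mathcal{C}_0$ is the Klein four-group, $o(v_1)\equiv 0\pmod 4$ when $\mathcal{C}_0^{\perp}/\mathcal{C}_0$ is cyclic of order $4$, and $o(v_2)\equiv 0\pmod 2$. Let $\mathcal{C}^*=\langle \{(v_1,c):c\in\mathcal{C}_1\}\cup\{(v_2,c):c\in\mathcal{C}_2\}\rangle\subseteq\mathbb{Z}_{2^m}^{k+n}$.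 Then $$\mathcal{C}^*=\{(iv_1+jv_2,c_{ij}):1\leq i\leq o(v_1),\ 1\leq j\leq o(v_2),\ c_{ij}\in\mathcal{C}_{\eta(i,j)}\},$$ $\mathcal{C}^*$ is a self-orthogonal code of length $n+k$ over $\mathbb{Z}_{2^m}$, and $$|\mathcal{C}^*|=o(v_1)o(v_2)|\mathcal{C}_0|=\tfrac12 o(v_1)o(v_2)|\mathcal{C}|=o(v_1)o(v_2)2^{\frac{mn}{2}-1}.$$
   Context: $m\geq 1$ is an integer and $\mathbb{Z}_{2^m}=\{0,1,\dots,2^m-1\}$ is the ring of integers modulo $2^m$. A (linear) code of length $N$ over $\mathbb{Z}_{2^m}$ is an additive subgroup of $\mathbb{Z}_{2^m}^N$. For $u,v\in\mathbb{Z}_{2^m}^N$, $u\cdot v=\sum_i u_iv_i \bmod 2^m$; $\mathcal{C}^{\perp}=\{v: u\cdot v=0 \text{ for all } u\in\mathcal{C}\}$; $\mathcal{C}$ is self-orthogonal if $\mathcal{C}\subseteq\mathcal{C}^\perp$ and self-dual if $\mathcal{C}=\mathcal{C}^{\perp}$. For a subset $A$, $\langle A\rangle$ is the additive subgroup generated by $A$. $o(v)$ is the additive order of $v$. For $v\in\mathbb{Z}_{2^m}^k$ and $c\in\mathbb{Z}_{2^m}^n$, $(v,c)\in\mathbb{Z}_{2^m}^{k+n}$ is the concatenation. For integers $a$ and $r\geq1$, $[a]_r$ is the remainder of $a$ upon division by $r$. The quotient $\mathcal{C}_0^\perp/\mathcal{C}_0$ (of order 4) is either the Klein four-group or cyclic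 of order 4, and $\eta(i,j)=[i]_2+2[j]_2$ in the Klein case, $\eta(i,j)=[i+2j]_4$ in the cyclic case. -}

module Defs where

open import Data.Nat using (ℕ; zero; suc; _+_; _*_; _∸_; _^_; _≤_; _<_; NonZero)
open import Data.Nat.Properties using (m^n≢0)
open import Data.Nat.DivMod using (_%_; m%n<n)
open import Data.Fin using (Fin; toℕ; fromℕ<)
open import Data.Vec using (Vec; []; _∷_; map; zipWith; foldr; replicate; _++_)
open import Data.List using (List; length)
open import Data.List.Membership.Propositional using (_∈_)
open import Data.List.Relation.Unary.Unique.Propositional using (Unique)
open import Data.Product using (Σ; _×_; ∃; _,_)
open import Data.Sum using (_⊎_)
open import Relation.Nullary using (¬_)
open import Data.Empty using (⊥)
open import Relation.Binary.PropositionalEquality using (_≡_)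
open import Function.Bundles using (_⇔_)

Zm : ℕ → Set
Zm m = Fin (2 ^ m)

private
  nz : ∀ m → NonZero (2 ^ m)
  nz m = m^n≢0 2 m

ofℕ : ∀ m → ℕ → Zm m
ofℕ m a = fromℕ< (m%n<n a (2 ^ m) {{nz m}})

0ₘ : ∀ m → Zm m
0ₘ m = ofℕ m 0

addₘ : ∀ m → Zm m → Zm m → Zm m
addₘ m a b = ofℕ m (toℕ a + toℕ b)

mulₘ : ∀ m → Zm m → Zm m → Zm m
mulₘ m a b = ofℕ m (toℕ a * toℕ b)

negₘ : ∀ m → Zm m → Zm m
negₘ m a = ofℕ m (2 ^ m ∸ toℕ a)

Word : ℕ → ℕ → Set
Word m N = Vec (Zm m) N

zeroW : ∀ m N → Word m N
zeroW m N = replicate N (0ₘ m)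

addW : ∀ m {N} → Word m N → Word m N → Word m N
addW m = zipWith (addₘ m)

negW : ∀ m {N} → Word m N → Word m N
negW m = map (negₘ m)

subW : ∀ m {N} → Word m N → Word m N → Word m N
subW m u v = addW m u (negW m v)

scaleW : ∀ m {N} → ℕ → Word m N → Word m N
scaleW m a = map (mulₘ m (ofℕ m a))

dot : ∀ m {N} → Word m N → Word m N → Zm m
dot m u v = foldr _ (addₘ m) (0ₘ m) (zipWith (mulₘ m) u v)

Code : ℕ → ℕ → Set₁
Code m N = Word m N → Set

IsCode : ∀ m N → Code m N → Set
IsCode m N C =
  C (zeroW m N)
  × (∀ u v → C u → C v → C (addW m u v))
  × (∀ u → C u → C (negW m u))

Dual : ∀ m N → Code m N → Code m N
Dual m N C v = ∀ u → C u → dot m u v ≡ 0ₘ m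

SelfOrthogonal : ∀ m N → Code m N → Set
SelfOrthogonal m N C = ∀ u → C u → Dual m N C u

SelfDual : ∀ m N → Code m N → Set
SelfDual m N C = ∀ v → C v ⇔ Dual m N C v

Subcode : ∀ m N → Code m N → Code m N → Set
Subcode m N C D = ∀ v → C v → D v

Coset : ∀ m N → Word m N → Code m N → Code m N
Coset m N x C c = C (subW m c x)

data Span (m N : ℕ) (A : Code m N) : Word m N → Set where
  gen  : ∀ {v} → A v → Span m N A v
  zer  : Span m N A (zeroW m N)
  plus : ∀ {u v} → Span m N A u → Span m N A v → Span m N A (addW m u v)
  neg  : ∀ {u} → Span m N A u → Span m N A (negW m u)

HasSize : ∀ m N → Code m N → ℕ → Set
HasSize m N P k =
  Σ (List (Word m N)) λ xs → Unique xs × (∀ v → P v ⇔ v ∈ xs) × length xs ≡ k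

IsOrder : ∀ m {N} → Word m N → ℕ → Set
IsOrder m {N} v r =
  1 ≤ r × scaleW m r v ≡ zeroW m N
  × (∀ r′ → 1 ≤ r′ → r′ < r → ¬ scaleW m r′ v ≡ zeroW m N)

data QuotType : Set where
  klein cyclic : QuotType

-- Klein four-group: every element of C₀^⊥/C₀ has order dividing 2;
-- cyclic of order 4: some element of C₀^⊥/C₀ has order 4 (i.e. not 2).
IsQuotType : ∀ m N → Code m N → QuotType → Set
IsQuotType m N C₀ klein  = ∀ x → Dual m N C₀ x → C₀ (addW m x x)
IsQuotType m N C₀ cyclic = Σ (Word m N) λ x → Dual m N C₀ x × ¬ C₀ (addW m x x)

η : QuotType → ℕ → ℕ → ℕ
η klein  i j = i % 2 + 2 * (j % 2)
η cyclic i j = (i + 2 * j) % 4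

Cᵢ : ∀ m N → Code m N → (s t : Word m N) → ℕ → Code m N
Cᵢ m N C₀ s t 0 = C₀
Cᵢ m N C₀ s t 1 = Coset m N s C₀
Cᵢ m N C₀ s t 2 = Coset m N t C₀
Cᵢ m N C₀ s t 3 = Coset m N (addW m s t) C₀
Cᵢ m N C₀ s t (suc (suc (suc (suc _)))) = λ _ → ⊥

GenStar : ∀ m k n → Code m n → (s t : Word m n) → (v₁ v₂ : Word m k) → Code m (k + n)
GenStar m k n C₀ s t v₁ v₂ w =
  (Σ (Word m n) λ c → Coset m n s C₀ c × w ≡ v₁ ++ c)
  ⊎ (Σ (Word m n) λ c → Coset m n t C₀ c × w ≡ v₂ ++ c)

CStar : ∀ m k n → Code m n → (s t : Word m n) → (v₁ v₂ : Word m k) → Code m (k + n)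
CStar m k n C₀ s t v₁ v₂ = Span m (k + n) (GenStar m k n C₀ s t v₁ v₂)

-- The words of C* are exactly Ψ i j x = (i v₁ + j v₂ , i s + j t + x) with x ∈ C₀, since these contain
-- the generators and are closed under addition and negation. Counting (|D| |D⊥| = 2^(mn) for every code D,
-- by induction on the length, splitting off the first coordinate) gives |C| = 2^(mn/2) and |C₀⊥| = 4 |C₀|,
-- so C₀⊥ is the union of the cosets C₀, s + C₀, t + C₀, s + t + C₀. In C₀⊥/C₀ one has 2t = 0, and 2s = 0
-- or 2s = t according as the quotient is a Klein group or cyclic; hence i s + j t lies in C_η(i,j), and
-- o₁ s, o₂ t ∈ C₀ by (P3), which is automatic when m = 1. So i and j can be reduced to 1 ≤ i ≤ o₁ and
-- 1 ≤ j ≤ o₂, and by (P1) this normal form is unique, giving |C*| = o₁ o₂ |C₀|. Self-orthogonality comes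
-- from (P2) on the generators, as inner products of elements of C₀⊥ only depend on their cosets.

module Submission where

open import Defs
open import Data.Nat as ℕ using (ℕ; zero; suc; _+_; _*_; _∸_; _^_; _≤_; _<_; NonZero; s≤s; z≤n)
import Data.Nat.Properties as ℕ
open import Data.Nat.DivMod
open import Data.Nat.Divisibility using (_∣_; divides; ∣-refl; n∣m*n; m%n≡0⇒n∣m; *-cancelˡ-∣)
open import Data.Nat.Primality using (euclidsLemma; prime[2])
open import Data.Nat.Solver using (module +-*-Solver)
open import Data.Fin as Fin using (Fin; toℕ; fromℕ; fromℕ<)
import Data.Fin.Properties as Fin
open import Data.Vec using ([]; _∷_; map; _++_)
import Data.Vec.Properties as Vec
open import Data.List as List using (List; []; _∷_; length; filter; cartesianProductWith; allFin)
open import Data.List.Properties using (length-++; length-map; length-tabulate)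
open import Data.List.Membership.Propositional using (_∈_)
open import Data.List.Membership.Propositional.Properties
  using (∈-++⁺ˡ; ∈-++⁺ʳ; ∈-++⁻; ∈-map⁺; ∈-map⁻; ∈-filter⁺; ∈-filter⁻; ∈-cartesianProductWith⁺; ∈-cartesianProductWith⁻; ∈-allFin)
open import Data.List.Membership.Propositional.Properties.WithK using (unique∧set⇒bag)
import Data.List.Membership.DecPropositional as DecMembership
open import Data.List.Relation.Binary.BagAndSetEquality using (∼bag⇒↭)
open import Data.List.Relation.Binary.Permutation.Propositional.Properties using (↭-length)
open import Data.List.Relation.Unary.Unique.Propositional using (Unique)
import Data.List.Relation.Unary.Unique.Propositional.Properties as Unique
open import Data.List.Relation.Unary.All as All using (All; [])
open import Data.List.Relation.Unary.AllPairs using ([]; _∷_)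
open import Data.List.Relation.Unary.Any using (here; there)
open import Data.Product using (Σ; _×_; _,_; proj₁; proj₂)
open import Data.Sum as Sum using (_⊎_; inj₁; inj₂; [_,_]′; reduce)
open import Data.Unit using (⊤; tt)
open import Data.Empty using (⊥; ⊥-elim)
open import Function using (_∘_; id)
open import Function.Bundles using (_⇔_; mk⇔; Equivalence)
open import Relation.Nullary using (¬_; Dec; yes; no; ¬?)
open import Relation.Nullary.Decidable using (map′; decidable-stable)
open import Relation.Binary.Definitions using (DecidableEquality)
open import Relation.Binary.PropositionalEquality
open import Algebra.Bundles using (AbelianGroup; CommutativeRing)
import Algebra.Properties.Ring as RingProperties
import Algebra.Properties.AbelianGroup as AbelianGroupProperties
import Algebra.Properties.CommutativeSemigroup as CommutativeSemigroupProperties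

open Equivalence using (to; from)

module ℤ₂ᵐ (m : ℕ) where

  M : ℕ
  M = 2 ^ m

  instance
    M≢0 : NonZero M
    M≢0 = ℕ.m^n≢0 2 m

  infixl 6 _⊕_
  infixl 7 _⊗_
  infix 8 ⊖_

  _⊕_ _⊗_ : Zm m → Zm m → Zm m
  _⊕_ = addₘ m
  _⊗_ = mulₘ m

  ⊖_ : Zm m → Zm m
  ⊖_ = negₘ m

  𝟘 𝟙 : Zm m
  𝟘 = 0ₘ m
  𝟙 = ofℕ m 1

  ι : ℕ → Zm m
  ι = ofℕ m

  toℕ-ι : ∀ a → toℕ (ι a) ≡ a % M
  toℕ-ι a = Fin.toℕ-fromℕ< (m%n<n a M)

  ι-cong : ∀ {a b} → a % M ≡ b % M → ι a ≡ ι b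
  ι-cong {a} {b} eq = Fin.toℕ-injective (trans (toℕ-ι a) (trans eq (sym (toℕ-ι b))))

  ι-injective-< : ∀ {a b} → a < M → b < M → ι a ≡ ι b → a ≡ b
  ι-injective-< {a} {b} a<M b<M eq = begin
    a          ≡⟨ m<n⇒m%n≡m a<M ⟨
    a % M      ≡⟨ toℕ-ι a ⟨
    toℕ (ι a)  ≡⟨ cong toℕ eq ⟩
    toℕ (ι b)  ≡⟨ toℕ-ι b ⟩
    b % M      ≡⟨ m<n⇒m%n≡m b<M ⟩
    b          ∎
    where open ≡-Reasoning

  ι-toℕ : ∀ x → ι (toℕ x) ≡ x
  ι-toℕ x = Fin.toℕ-injective (trans (toℕ-ι (toℕ x)) (m<n⇒m%n≡m (Fin.toℕ<n x)))

  0%M≡0 : 0 % M ≡ 0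
  0%M≡0 = m<n⇒m%n≡m (ℕ.m^n>0 2 m)

  ι-M : ι M ≡ 𝟘
  ι-M = ι-cong (trans (n%n≡0 M) (sym 0%M≡0))

  ι≡𝟘⇒M∣ : ∀ {a} → ι a ≡ 𝟘 → M ∣ a
  ι≡𝟘⇒M∣ {a} eq = m%n≡0⇒n∣m a M (trans (sym (toℕ-ι a)) (trans (cong toℕ eq) (trans (toℕ-ι 0) 0%M≡0)))

  ι-+ : ∀ a b → ι a ⊕ ι b ≡ ι (a + b)
  ι-+ a b = ι-cong (begin
    (toℕ (ι a) + toℕ (ι b)) % M ≡⟨ cong₂ (λ x y → (x + y) % M) (toℕ-ι a) (toℕ-ι b) ⟩
    (a % M + b % M) % M         ≡⟨ %-distribˡ-+ a b M ⟨
    (a + b) % M                 ∎)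
    where open ≡-Reasoning

  ι-* : ∀ a b → ι a ⊗ ι b ≡ ι (a * b)
  ι-* a b = ι-cong (begin
    (toℕ (ι a) * toℕ (ι b)) % M ≡⟨ cong₂ (λ x y → (x * y) % M) (toℕ-ι a) (toℕ-ι b) ⟩
    (a % M * (b % M)) % M       ≡⟨ %-distribˡ-* a b M ⟨
    (a * b) % M                 ∎)
    where open ≡-Reasoning

  -- x ⊕ y and x ⊗ y are by definition ι (⟦ x ⟧ + ⟦ y ⟧) and ι (⟦ x ⟧ * ⟦ y ⟧), so the ring laws are
  -- inherited from ℕ along ι-+ and ι-*.
  private
    ⟦_⟧ : Zm m → ℕ
    ⟦_⟧ = toℕ

    ι⟦_⟧ : ∀ x → x ≡ ι ⟦ x ⟧
    ι⟦ x ⟧ = sym (ι-toℕ x)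

  ⊕-comm : ∀ x y → x ⊕ y ≡ y ⊕ x
  ⊕-comm x y = cong ι (ℕ.+-comm ⟦ x ⟧ ⟦ y ⟧)

  ⊗-comm : ∀ x y → x ⊗ y ≡ y ⊗ x
  ⊗-comm x y = cong ι (ℕ.*-comm ⟦ x ⟧ ⟦ y ⟧)

  ⊕-assoc : ∀ x y z → (x ⊕ y) ⊕ z ≡ x ⊕ (y ⊕ z)
  ⊕-assoc x y z = begin
    ι (⟦ x ⟧ + ⟦ y ⟧) ⊕ z          ≡⟨ cong (ι (⟦ x ⟧ + ⟦ y ⟧) ⊕_) ι⟦ z ⟧ ⟩
    ι (⟦ x ⟧ + ⟦ y ⟧) ⊕ ι ⟦ z ⟧    ≡⟨ ι-+ _ _ ⟩
    ι (⟦ x ⟧ + ⟦ y ⟧ + ⟦ z ⟧)      ≡⟨ cong ι (ℕ.+-assoc ⟦ x ⟧ _ _) ⟩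
    ι (⟦ x ⟧ + (⟦ y ⟧ + ⟦ z ⟧))    ≡⟨ ι-+ _ _ ⟨
    ι ⟦ x ⟧ ⊕ ι (⟦ y ⟧ + ⟦ z ⟧)    ≡⟨ cong (_⊕ (y ⊕ z)) ι⟦ x ⟧ ⟨
    x ⊕ (y ⊕ z)                    ∎
    where open ≡-Reasoning

  ⊗-assoc : ∀ x y z → (x ⊗ y) ⊗ z ≡ x ⊗ (y ⊗ z)
  ⊗-assoc x y z = begin
    ι (⟦ x ⟧ * ⟦ y ⟧) ⊗ z          ≡⟨ cong (ι (⟦ x ⟧ * ⟦ y ⟧) ⊗_) ι⟦ z ⟧ ⟩
    ι (⟦ x ⟧ * ⟦ y ⟧) ⊗ ι ⟦ z ⟧    ≡⟨ ι-* _ _ ⟩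
    ι (⟦ x ⟧ * ⟦ y ⟧ * ⟦ z ⟧)      ≡⟨ cong ι (ℕ.*-assoc ⟦ x ⟧ _ _) ⟩
    ι (⟦ x ⟧ * (⟦ y ⟧ * ⟦ z ⟧))    ≡⟨ ι-* _ _ ⟨
    ι ⟦ x ⟧ ⊗ ι (⟦ y ⟧ * ⟦ z ⟧)    ≡⟨ cong (_⊗ (y ⊗ z)) ι⟦ x ⟧ ⟨
    x ⊗ (y ⊗ z)                    ∎
    where open ≡-Reasoning

  ⊗-distribˡ-⊕ : ∀ x y z → x ⊗ (y ⊕ z) ≡ x ⊗ y ⊕ x ⊗ z
  ⊗-distribˡ-⊕ x y z = begin
    x ⊗ ι (⟦ y ⟧ + ⟦ z ⟧)           ≡⟨ cong (_⊗ (y ⊕ z)) ι⟦ x ⟧ ⟩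
    ι ⟦ x ⟧ ⊗ ι (⟦ y ⟧ + ⟦ z ⟧)     ≡⟨ ι-* _ _ ⟩
    ι (⟦ x ⟧ * (⟦ y ⟧ + ⟦ z ⟧))     ≡⟨ cong ι (ℕ.*-distribˡ-+ ⟦ x ⟧ _ _) ⟩
    ι (⟦ x ⟧ * ⟦ y ⟧ + ⟦ x ⟧ * ⟦ z ⟧) ≡⟨ ι-+ _ _ ⟨
    x ⊗ y ⊕ x ⊗ z                   ∎
    where open ≡-Reasoning

  ⊕-identityˡ : ∀ x → 𝟘 ⊕ x ≡ x
  ⊕-identityˡ x = trans (cong (𝟘 ⊕_) ι⟦ x ⟧) (trans (ι-+ 0 ⟦ x ⟧) (ι-toℕ x))

  ⊗-identityˡ : ∀ x → 𝟙 ⊗ x ≡ x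
  ⊗-identityˡ x = trans (cong (𝟙 ⊗_) ι⟦ x ⟧) (trans (ι-* 1 ⟦ x ⟧) (trans (cong ι (ℕ.*-identityˡ ⟦ x ⟧)) (ι-toℕ x)))

  ⊖-inverseʳ : ∀ x → x ⊕ ⊖ x ≡ 𝟘
  ⊖-inverseʳ x = begin
    x ⊕ ι (M ∸ ⟦ x ⟧)             ≡⟨ cong (_⊕ ⊖ x) ι⟦ x ⟧ ⟩
    ι ⟦ x ⟧ ⊕ ι (M ∸ ⟦ x ⟧)       ≡⟨ ι-+ _ _ ⟩
    ι (⟦ x ⟧ + (M ∸ ⟦ x ⟧))       ≡⟨ cong ι (ℕ.m+[n∸m]≡n (ℕ.<⇒≤ (Fin.toℕ<n x))) ⟩
    ι M                           ≡⟨ ι-M ⟩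
    𝟘                             ∎
    where open ≡-Reasoning

  +-*-commutativeRing : CommutativeRing _ _
  +-*-commutativeRing = record
    { Carrier = Zm m ; _≈_ = _≡_ ; _+_ = _⊕_ ; _*_ = _⊗_ ; -_ = ⊖_ ; 0# = 𝟘 ; 1# = 𝟙
    ; isCommutativeRing = record
      { isRing = record
        { +-isAbelianGroup = record
          { isGroup = record
            { isMonoid = record
              { isSemigroup = record
                { isMagma = record { isEquivalence = isEquivalence ; ∙-cong = cong₂ _⊕_ }
                ; assoc = ⊕-assoc }
              ; identity = ⊕-identityˡ , λ x → trans (⊕-comm x 𝟘) (⊕-identityˡ x) }
            ; inverse = (λ x → trans (⊕-comm (⊖ x) x) (⊖-inverseʳ x)) , ⊖-inverseʳ
            ; ⁻¹-cong = cong ⊖_ }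
          ; comm = ⊕-comm }
        ; *-cong = cong₂ _⊗_
        ; *-assoc = ⊗-assoc
        ; *-identity = ⊗-identityˡ , λ x → trans (⊗-comm x 𝟙) (⊗-identityˡ x)
        ; distrib = ⊗-distribˡ-⊕ , λ x y z → trans (⊗-comm (y ⊕ z) x)
                      (trans (⊗-distribˡ-⊕ x y z) (cong₂ _⊕_ (⊗-comm x y) (⊗-comm x z))) }
      ; *-comm = ⊗-comm } }

  module Zm = CommutativeRing +-*-commutativeRing
  module Zmᴾ = RingProperties Zm.ring
  module Zm⁺ = CommutativeSemigroupProperties Zm.+-commutativeSemigroup

  ι-⊗ : ∀ a x → ι a ⊗ x ≡ ι (a * toℕ x)
  ι-⊗ a x = trans (cong (ι a ⊗_) (sym (ι-toℕ x))) (ι-* a (toℕ x))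

module Words (m : ℕ) where

  open ℤ₂ᵐ m public

  infixl 6 _+ᵥ_
  infix 6.5 -ᵥ_
  infixr 7 _·_

  _+ᵥ_ : ∀ {N} → Word m N → Word m N → Word m N
  _+ᵥ_ = addW m

  -ᵥ_ : ∀ {N} → Word m N → Word m N
  -ᵥ_ = negW m

  𝟎 : ∀ N → Word m N
  𝟎 = zeroW m

  _·_ : ∀ {N} → ℕ → Word m N → Word m N
  _·_ = scaleW m

  ⟨_,_⟩ : ∀ {N} → Word m N → Word m N → Zm m
  ⟨_,_⟩ = dot m

  +ᵥ-abelianGroup : ℕ → AbelianGroup _ _
  +ᵥ-abelianGroup N = record
    { Carrier = Word m N ; _≈_ = _≡_ ; _∙_ = _+ᵥ_ ; ε = 𝟎 N ; _⁻¹ = -ᵥ_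
    ; isAbelianGroup = record
      { isGroup = record
        { isMonoid = record
          { isSemigroup = record
            { isMagma = record { isEquivalence = isEquivalence ; ∙-cong = cong₂ _+ᵥ_ }
            ; assoc = Vec.zipWith-assoc Zm.+-assoc }
          ; identity = Vec.zipWith-identityˡ Zm.+-identityˡ , Vec.zipWith-identityʳ Zm.+-identityʳ }
        ; inverse = Vec.zipWith-inverseˡ Zm.-‿inverseˡ , Vec.zipWith-inverseʳ Zm.-‿inverseʳ
        ; ⁻¹-cong = cong -ᵥ_ }
      ; comm = Vec.zipWith-comm Zm.+-comm } }

  module W {N : ℕ} = AbelianGroup (+ᵥ-abelianGroup N)
  module Wᴾ {N : ℕ} = AbelianGroupProperties (+ᵥ-abelianGroup N)
  module W⁺ {N : ℕ} = CommutativeSemigroupProperties (W.commutativeSemigroup {N})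

  x+[y-x]≡y : ∀ {N} (x y : Word m N) → x +ᵥ (y +ᵥ -ᵥ x) ≡ y
  x+[y-x]≡y x y = trans (W.comm x _) (Wᴾ.//-rightDividesˡ x y)

  [x+y]-x≡y : ∀ {N} (x y : Word m N) → (x +ᵥ y) +ᵥ -ᵥ x ≡ y
  [x+y]-x≡y x y = trans (cong (_+ᵥ -ᵥ x) (W.comm x y)) (Wᴾ.//-rightDividesʳ x y)

  ·-+ : ∀ {N} a b (v : Word m N) → (a + b) · v ≡ a · v +ᵥ b · v
  ·-+ a b []      = refl
  ·-+ a b (x ∷ v) = cong₂ _∷_ (trans (cong (_⊗ x) (sym (ι-+ a b))) (Zm.distribʳ x (ι a) (ι b))) (·-+ a b v)

  ·-* : ∀ {N} a b (v : Word m N) → (a * b) · v ≡ a · b · v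
  ·-* a b []      = refl
  ·-* a b (x ∷ v) = cong₂ _∷_ (trans (cong (_⊗ x) (sym (ι-* a b))) (Zm.*-assoc (ι a) (ι b) x)) (·-* a b v)

  ·-distrib : ∀ {N} a (u v : Word m N) → a · (u +ᵥ v) ≡ a · u +ᵥ a · v
  ·-distrib a []      []      = refl
  ·-distrib a (x ∷ u) (y ∷ v) = cong₂ _∷_ (Zm.distribˡ (ι a) x y) (·-distrib a u v)

  ·-cong : ∀ {N} {a b} (v : Word m N) → a % M ≡ b % M → a · v ≡ b · v
  ·-cong v eq = cong (λ c → map (c ⊗_) v) (ι-cong eq)

  0· : ∀ {N} (v : Word m N) → 0 · v ≡ 𝟎 N
  0· []      = refl
  0· (x ∷ v) = cong₂ _∷_ (Zm.zeroˡ x) (0· v)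

  1· : ∀ {N} (v : Word m N) → 1 · v ≡ v
  1· []      = refl
  1· (x ∷ v) = cong₂ _∷_ (Zm.*-identityˡ x) (1· v)

  suc· : ∀ {N} a (v : Word m N) → suc a · v ≡ v +ᵥ a · v
  suc· a v = trans (·-+ 1 a v) (cong (_+ᵥ a · v) (1· v))

  2·≡+ᵥ : ∀ {N} (v : Word m N) → 2 · v ≡ v +ᵥ v
  2·≡+ᵥ v = trans (suc· 1 v) (cong (v +ᵥ_) (1· v))

  M· : ∀ {N} (v : Word m N) → M · v ≡ 𝟎 N
  M· v = trans (·-cong v (trans (n%n≡0 M) (sym 0%M≡0))) (0· v)

  m≡1⇒2·≡𝟎 : ∀ {N} → m ≡ 1 → (v : Word m N) → 2 · v ≡ 𝟎 N
  m≡1⇒2·≡𝟎 refl = M·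

  ·𝟎 : ∀ N a → a · 𝟎 N ≡ 𝟎 N
  ·𝟎 zero    a = refl
  ·𝟎 (suc N) a = cong₂ _∷_ (Zm.zeroʳ (ι a)) (·𝟎 N a)

  ·-neg : ∀ {N} a (v : Word m N) → a · (-ᵥ v) ≡ -ᵥ a · v
  ·-neg {N} a v = Wᴾ.inverseʳ-unique (a · v) (a · (-ᵥ v)) (begin
    a · v +ᵥ a · (-ᵥ v) ≡⟨ ·-distrib a v (-ᵥ v) ⟨
    a · (v +ᵥ -ᵥ v)    ≡⟨ cong (a ·_) (W.inverseʳ v) ⟩
    a · 𝟎 N            ≡⟨ ·𝟎 N a ⟩
    𝟎 N                ∎)
    where open ≡-Reasoning

  -ᵥ≡[M∸1]· : ∀ {N} (v : Word m N) → -ᵥ v ≡ (M ∸ 1) · v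
  -ᵥ≡[M∸1]· {N} v = sym (Wᴾ.inverseʳ-unique v ((M ∸ 1) · v) (begin
    v +ᵥ (M ∸ 1) · v   ≡⟨ suc· (M ∸ 1) v ⟨
    suc (M ∸ 1) · v    ≡⟨ cong (_· v) (ℕ.suc-pred M) ⟩
    M · v              ≡⟨ M· v ⟩
    𝟎 N                ∎))
    where open ≡-Reasoning

  ·≡·% : ∀ {N o} .{{_ : NonZero o}} {v : Word m N} → o · v ≡ 𝟎 N → ∀ α → α · v ≡ (α % o) · v
  ·≡·% {N} {o} {v} o·v≡𝟎 α = begin
    α · v                                    ≡⟨ cong (_· v) (m≡m%n+[m/n]*n α o) ⟩
    (α % o + α / o * o) · v                  ≡⟨ ·-+ (α % o) _ v ⟩
    (α % o) · v +ᵥ (α / o * o) · v           ≡⟨ cong ((α % o) · v +ᵥ_) (trans (·-* (α / o) o v) (cong ((α / o) ·_) o·v≡𝟎)) ⟩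
    (α % o) · v +ᵥ (α / o) · 𝟎 N             ≡⟨ cong ((α % o) · v +ᵥ_) (·𝟎 N (α / o)) ⟩
    (α % o) · v +ᵥ 𝟎 N                       ≡⟨ W.identityʳ _ ⟩
    (α % o) · v                              ∎
    where open ≡-Reasoning

  order≡2 : ∀ {N o} {v : Word m N} → IsOrder m v o → ¬ v ≡ 𝟎 N → 2 · v ≡ 𝟎 N → o ≡ 2
  order≡2 {o = 0}                 (() , _)
  order≡2 {o = 1}     {v}         (_ , 1·v≡𝟎 , _) v≢𝟎 _ = ⊥-elim (v≢𝟎 (trans (sym (1· v)) 1·v≡𝟎))
  order≡2 {o = 2}                 _ _ _ = refl
  order≡2 {o = suc (suc (suc _))} (_ , _ , minimal) _ 2·v≡𝟎 = ⊥-elim (minimal 2 (s≤s z≤n) (s≤s (s≤s (s≤s z≤n))) 2·v≡𝟎)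

  +ᵥ-++ : ∀ {k N} (u : Word m k) (v : Word m N) u′ v′ → (u ++ v) +ᵥ (u′ ++ v′) ≡ (u +ᵥ u′) ++ (v +ᵥ v′)
  +ᵥ-++ = Vec.zipWith-++ (addₘ m)

  ·-++ : ∀ {k N} a (u : Word m k) (v : Word m N) → a · (u ++ v) ≡ a · u ++ a · v
  ·-++ a = Vec.map-++ (ι a ⊗_)

  𝟎-++ : ∀ k N → 𝟎 (k + N) ≡ 𝟎 k ++ 𝟎 N
  𝟎-++ zero    N = refl
  𝟎-++ (suc k) N = cong (𝟘 ∷_) (𝟎-++ k N)

  dot-comm : ∀ {N} (u v : Word m N) → ⟨ u , v ⟩ ≡ ⟨ v , u ⟩
  dot-comm []      []      = refl
  dot-comm (x ∷ u) (y ∷ v) = cong₂ _⊕_ (Zm.*-comm x y) (dot-comm u v)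

  dot-𝟎ˡ : ∀ {N} (v : Word m N) → ⟨ 𝟎 N , v ⟩ ≡ 𝟘
  dot-𝟎ˡ []      = refl
  dot-𝟎ˡ (y ∷ v) = trans (cong₂ _⊕_ (Zm.zeroˡ y) (dot-𝟎ˡ v)) (Zm.+-identityˡ 𝟘)

  dot-+ˡ : ∀ {N} (u u′ v : Word m N) → ⟨ u +ᵥ u′ , v ⟩ ≡ ⟨ u , v ⟩ ⊕ ⟨ u′ , v ⟩
  dot-+ˡ []       []         []      = sym (Zm.+-identityˡ 𝟘)
  dot-+ˡ (x ∷ u) (x′ ∷ u′) (y ∷ v) =
    trans (cong₂ _⊕_ (Zm.distribʳ y x x′) (dot-+ˡ u u′ v)) (Zm⁺.interchange (x ⊗ y) (x′ ⊗ y) ⟨ u , v ⟩ ⟨ u′ , v ⟩)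

  dot-+ʳ : ∀ {N} (u v v′ : Word m N) → ⟨ u , v +ᵥ v′ ⟩ ≡ ⟨ u , v ⟩ ⊕ ⟨ u , v′ ⟩
  dot-+ʳ u v v′ = trans (dot-comm u _) (trans (dot-+ˡ v v′ u) (cong₂ _⊕_ (dot-comm v u) (dot-comm v′ u)))

  dot-negˡ : ∀ {N} (u v : Word m N) → ⟨ -ᵥ u , v ⟩ ≡ ⊖ ⟨ u , v ⟩
  dot-negˡ {N} u v = Zmᴾ.+-inverseʳ-unique ⟨ u , v ⟩ ⟨ -ᵥ u , v ⟩
    (trans (sym (dot-+ˡ u (-ᵥ u) v)) (trans (cong ⟨_, v ⟩ (W.inverseʳ u)) (dot-𝟎ˡ v)))

  dot-·ˡ : ∀ {N} a (u v : Word m N) → ⟨ a · u , v ⟩ ≡ ι a ⊗ ⟨ u , v ⟩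
  dot-·ˡ a []      []      = sym (Zm.zeroʳ (ι a))
  dot-·ˡ a (x ∷ u) (y ∷ v) = trans (cong₂ _⊕_ (Zm.*-assoc (ι a) x y) (dot-·ˡ a u v)) (sym (Zm.distribˡ (ι a) _ _))

  dot-++ : ∀ {k N} (u u′ : Word m k) (v v′ : Word m N) → ⟨ u ++ v , u′ ++ v′ ⟩ ≡ ⟨ u , u′ ⟩ ⊕ ⟨ v , v′ ⟩
  dot-++ []      []       v v′ = sym (Zm.+-identityˡ _)
  dot-++ (x ∷ u) (y ∷ u′) v v′ = trans (cong (x ⊗ y ⊕_) (dot-++ u u′ v v′)) (sym (Zm.+-assoc _ _ _))

  lin : ∀ {N} → Word m N → Word m N → ℕ → ℕ → Word m N
  lin x y i j = i · x +ᵥ j · y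

  lin-+ : ∀ {N} (x y : Word m N) i j i′ j′ → lin x y (i + i′) (j + j′) ≡ lin x y i j +ᵥ lin x y i′ j′
  lin-+ x y i j i′ j′ = trans (cong₂ _+ᵥ_ (·-+ i i′ x) (·-+ j j′ y)) (W⁺.interchange (i · x) (i′ · x) (j · y) (j′ · y))

  lin-· : ∀ {N} (x y : Word m N) a i j → a · lin x y i j ≡ lin x y (a * i) (a * j)
  lin-· x y a i j = trans (·-distrib a (i · x) (j · y)) (sym (cong₂ _+ᵥ_ (·-* a i x) (·-* a j y)))

  lin-0-0 : ∀ {N} (x y : Word m N) → lin x y 0 0 ≡ 𝟎 N
  lin-0-0 {N} x y = trans (cong₂ _+ᵥ_ (0· x) (0· y)) (W.identityˡ (𝟎 N))

  lin-1-0 : ∀ {N} (x y : Word m N) → lin x y 1 0 ≡ x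
  lin-1-0 x y = trans (cong₂ _+ᵥ_ (1· x) (0· y)) (W.identityʳ x)

  lin-0-1 : ∀ {N} (x y : Word m N) → lin x y 0 1 ≡ y
  lin-0-1 x y = trans (cong₂ _+ᵥ_ (0· x) (1· y)) (W.identityˡ y)

Size : {A : Set} → (A → Set) → ℕ → Set
Size {A} P k = Σ (List A) λ xs → Unique xs × (∀ v → P v ⇔ v ∈ xs) × length xs ≡ k

length-≡ : {A : Set} {xs ys : List A} → Unique xs → Unique ys → (∀ v → v ∈ xs ⇔ v ∈ ys) → length xs ≡ length ys
length-≡ uxs uys eq = ↭-length (∼bag⇒↭ (unique∧set⇒bag uxs uys (λ {v} → eq v)))

module _ {A : Set} where

  size-unique : ∀ {P Q : A → Set} {a b} → Size P a → Size Q b → (∀ v → P v ⇔ Q v) → a ≡ b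
  size-unique (xs , uxs , exs , refl) (ys , uys , eys , refl) eq = length-≡ uxs uys λ v →
    mk⇔ (λ p → to (eys v) (to (eq v) (from (exs v) p))) (λ p → to (exs v) (from (eq v) (from (eys v) p)))

  size-resp : ∀ {P Q : A → Set} {a} → (∀ v → P v ⇔ Q v) → Size P a → Size Q a
  size-resp eq (xs , uxs , exs , len) =
    xs , uxs , (λ v → mk⇔ (λ q → to (exs v) (from (eq v) q)) (λ p → to (eq v) (from (exs v) p))) , len

  size-⊎ : ∀ {P Q : A → Set} {a b} → (∀ v → P v → Q v → ⊥) → Size P a → Size Q b → Size (λ v → P v ⊎ Q v) (a + b)
  size-⊎ disjoint (xs , uxs , exs , refl) (ys , uys , eys , refl) =
    xs List.++ ys , Unique.++⁺ uxs uys (λ {v} (p , q) → disjoint v (from (exs v) p) (from (eys v) q)) ,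
    (λ v → mk⇔ Sum.[ (λ p → ∈-++⁺ˡ (to (exs v) p)) , (λ q → ∈-++⁺ʳ xs (to (eys v) q)) ]
               (λ r → Sum.map (from (exs v)) (from (eys v)) (∈-++⁻ xs r))) ,
    length-++ xs

  size-nonempty : ∀ {P : A → Set} {a} x → P x → Size P a → 1 ≤ a
  size-nonempty x px (_ ∷ _ , _ , _ , refl) = s≤s z≤n
  size-nonempty x px ([] , _ , exs , refl) with () ← to (exs x) px

size-image : ∀ {A B : Set} {P : A → Set} {a} (f : A → B) → (∀ {x y} → f x ≡ f y → x ≡ y) →
             Size P a → Size (λ v → Σ A λ x → P x × v ≡ f x) a
size-image f f-inj (xs , uxs , exs , refl) =
  List.map f xs , Unique.map⁺ f-inj uxs ,
  (λ v → mk⇔ (λ { (x , px , refl) → ∈-map⁺ f (to (exs x) px) })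
             (λ r → let (x , x∈ , eq) = ∈-map⁻ f r in x , from (exs x) x∈ , eq)) ,
  length-map f xs

length-cartesianProductWith : ∀ {A B C : Set} (f : A → B → C) xs ys →
  length (cartesianProductWith f xs ys) ≡ length xs * length ys
length-cartesianProductWith f []       ys = refl
length-cartesianProductWith f (x ∷ xs) ys =
  trans (length-++ (List.map (f x) ys)) (cong₂ _+_ (length-map (f x) ys) (length-cartesianProductWith f xs ys))

size-product : ∀ {A B C : Set} {P : A → Set} {Q : B → Set} {a b} (f : A → B → C) →
               (∀ {x x′ y y′} → f x y ≡ f x′ y′ → x ≡ x′ × y ≡ y′) →
               Size P a → Size Q b → Size (λ v → Σ A λ x → Σ B λ y → P x × Q y × v ≡ f x y) (a * b)
size-product f f-inj (xs , uxs , exs , refl) (ys , uys , eys , refl) =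
  cartesianProductWith f xs ys , Unique.cartesianProductWith⁺ f f-inj uxs uys ,
  (λ v → mk⇔ (λ { (x , y , px , qy , refl) → ∈-cartesianProductWith⁺ f (to (exs x) px) (to (eys y) qy) })
             (λ r → let (x , y , x∈ , y∈ , eq) = ∈-cartesianProductWith⁻ f xs ys r
                    in x , y , from (exs x) x∈ , from (eys y) y∈ , eq)) ,
  length-cartesianProductWith f xs ys

size-Fin : ∀ n → Size {Fin n} (λ _ → ⊤) n
size-Fin n = allFin n , Unique.allFin⁺ n , (λ i → mk⇔ (λ _ → ∈-allFin i) (λ _ → tt)) , length-tabulate _

module WithDecidableEquality {A : Set} (_≟_ : DecidableEquality A) where
  open DecMembership _≟_ using (_∈?_)

  length-mono : {xs ys : List A} → Unique xs → Unique ys → (∀ v → v ∈ xs → v ∈ ys) → length xs ≤ length ys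
  length-mono {xs} {ys} uxs uys xs⊆ys = subst (length xs ≤_) lengths (ℕ.m≤m+n (length xs) (length rest))
    where
    rest = filter (λ v → ¬? (v ∈? xs)) ys
    ∈-rest⁻ : ∀ {v} → v ∈ rest → v ∈ ys × ¬ v ∈ xs
    ∈-rest⁻ = ∈-filter⁻ (λ v → ¬? (v ∈? xs)) {xs = ys}
    same-members : ∀ v → v ∈ xs List.++ rest ⇔ v ∈ ys
    same-members v = mk⇔ (λ p → Sum.[ xs⊆ys v , (λ q → proj₁ (∈-rest⁻ q)) ] (∈-++⁻ xs p)) back
      where
      back : v ∈ ys → v ∈ xs List.++ rest
      back p with v ∈? xs
      ... | yes q = ∈-++⁺ˡ q
      ... | no q  = ∈-++⁺ʳ xs (∈-filter⁺ (λ v → ¬? (v ∈? xs)) p q)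
    lengths : length xs + length rest ≡ length ys
    lengths = trans (sym (length-++ xs))
      (length-≡ (Unique.++⁺ uxs (Unique.filter⁺ _ uys) (λ (p , q) → proj₂ (∈-rest⁻ q) p)) uys same-members)

  size-dec : ∀ {P : A → Set} {a} → Size P a → ∀ v → Dec (P v)
  size-dec (xs , _ , exs , _) v with v ∈? xs
  ... | yes p = yes (from (exs v) p)
  ... | no ¬p = no (λ q → ¬p (to (exs v) q))

  size-cover : ∀ {P Q : A → Set} {a} → Size P a → Size Q a → (∀ v → P v → Q v) → ∀ v → Q v → P v
  size-cover (xs , uxs , exs , refl) (ys , uys , eys , len) P⊆Q w qw with size-dec (xs , uxs , exs , refl) w
  ... | yes pw = pw
  ... | no ¬pw = ⊥-elim (ℕ.<-irrefl (sym len) (length-mono (w∉xs ∷ uxs) uys w∷xs⊆ys))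
    where
    w∉xs : All (λ y → ¬ w ≡ y) xs
    w∉xs = All.tabulate (λ {y} y∈xs w≡y → ¬pw (from (exs w) (subst (_∈ xs) (sym w≡y) y∈xs)))
    w∷xs⊆ys : ∀ v → v ∈ w ∷ xs → v ∈ ys
    w∷xs⊆ys v (here refl) = to (eys v) qw
    w∷xs⊆ys v (there p)   = to (eys v) (P⊆Q v (from (exs v) p))

size-singleton : ∀ {A : Set} (x : A) → Size (_≡ x) 1
size-singleton x = x ∷ [] , [] ∷ [] , (λ v → mk⇔ (λ { refl → here refl }) (λ { (here eq) → eq })) , refl

module CodeProperties (m : ℕ) {N} (C : Code m N) (isC : IsCode m N C) where

  open Words m

  C-𝟎 : C (𝟎 N)
  C-𝟎 = proj₁ isC

  C-+ : ∀ {u v} → C u → C v → C (u +ᵥ v)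
  C-+ {u} {v} = proj₁ (proj₂ isC) u v

  C-neg : ∀ {u} → C u → C (-ᵥ u)
  C-neg {u} = proj₂ (proj₂ isC) u

  C-· : ∀ a {u} → C u → C (a · u)
  C-· zero    {u} _  = subst C (sym (0· u)) C-𝟎
  C-· (suc a) {u} cu = subst C (sym (suc· a u)) (C-+ cu (C-· a cu))

  infix 4 _~_

  _~_ : Word m N → Word m N → Set
  x ~ y = C (x +ᵥ -ᵥ y)

  ≡⇒~ : ∀ {x y} → x ≡ y → x ~ y
  ≡⇒~ {x} refl = subst C (sym (W.inverseʳ x)) C-𝟎

  ~-refl : ∀ {x} → x ~ x
  ~-refl = ≡⇒~ refl

  ~-sym : ∀ {x y} → x ~ y → y ~ x
  ~-sym {x} {y} x~y = subst C (Wᴾ.⁻¹-anti-homo‿- x y) (C-neg x~y)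

  ~-trans : ∀ {x y z} → x ~ y → y ~ z → x ~ z
  ~-trans {x} {y} {z} x~y y~z = subst C telescope (C-+ x~y y~z)
    where
    open ≡-Reasoning
    telescope : (x +ᵥ -ᵥ y) +ᵥ (y +ᵥ -ᵥ z) ≡ x +ᵥ -ᵥ z
    telescope = begin
      (x +ᵥ -ᵥ y) +ᵥ (y +ᵥ -ᵥ z)  ≡⟨ W.assoc x (-ᵥ y) _ ⟩
      x +ᵥ (-ᵥ y +ᵥ (y +ᵥ -ᵥ z))  ≡⟨ cong (x +ᵥ_) (W.assoc (-ᵥ y) y _) ⟨
      x +ᵥ ((-ᵥ y +ᵥ y) +ᵥ -ᵥ z)  ≡⟨ cong (λ w → x +ᵥ (w +ᵥ -ᵥ z)) (W.inverseˡ y) ⟩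
      x +ᵥ (𝟎 N +ᵥ -ᵥ z)          ≡⟨ cong (x +ᵥ_) (W.identityˡ (-ᵥ z)) ⟩
      x +ᵥ -ᵥ z                   ∎

  ~-+ : ∀ {x x′ y y′} → x ~ x′ → y ~ y′ → x +ᵥ y ~ x′ +ᵥ y′
  ~-+ {x} {x′} {y} {y′} x~x′ y~y′ = subst C rearrange (C-+ x~x′ y~y′)
    where
    open ≡-Reasoning
    rearrange : (x +ᵥ -ᵥ x′) +ᵥ (y +ᵥ -ᵥ y′) ≡ (x +ᵥ y) +ᵥ -ᵥ (x′ +ᵥ y′)
    rearrange = begin
      (x +ᵥ -ᵥ x′) +ᵥ (y +ᵥ -ᵥ y′)  ≡⟨ W⁺.interchange x (-ᵥ x′) y (-ᵥ y′) ⟩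
      (x +ᵥ y) +ᵥ (-ᵥ x′ +ᵥ -ᵥ y′)  ≡⟨ cong ((x +ᵥ y) +ᵥ_) (Wᴾ.⁻¹-∙-comm x′ y′) ⟩
      (x +ᵥ y) +ᵥ -ᵥ (x′ +ᵥ y′)     ∎

  ~-cancelˡ : ∀ {x y z} → x +ᵥ y ~ x +ᵥ z → y ~ z
  ~-cancelˡ {x} {y} {z} p = subst₂ _~_ (Wᴾ.\\-leftDividesʳ x y) (Wᴾ.\\-leftDividesʳ x z) (~-+ (~-refl {x = -ᵥ x}) p)

  ~-· : ∀ a {x y} → x ~ y → a · x ~ a · y
  ~-· a {x} {y} x~y = subst C (trans (·-distrib a x (-ᵥ y)) (cong (a · x +ᵥ_) (·-neg a y))) (C-· a x~y)

  ∈⇒~𝟎 : ∀ {x} → C x → x ~ 𝟎 N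
  ∈⇒~𝟎 {x} = subst C (sym (trans (cong (x +ᵥ_) Wᴾ.ε⁻¹≈ε) (W.identityʳ x)))

  ~𝟎⇒∈ : ∀ {x} → x ~ 𝟎 N → C x
  ~𝟎⇒∈ {x} = subst C (trans (cong (x +ᵥ_) Wᴾ.ε⁻¹≈ε) (W.identityʳ x))

  +-~ˡ : ∀ {x y} → C y → x +ᵥ y ~ x
  +-~ˡ {x} {y} cy = ~-trans (~-+ (~-refl {x}) (∈⇒~𝟎 cy)) (≡⇒~ (W.identityʳ x))

  coset-size : ∀ {a} x → Size C a → Size (Coset m N x C) a
  coset-size x sizeC = size-resp equiv (size-image (x +ᵥ_) (Wᴾ.∙-cancelˡ x _ _) sizeC)
    where
    equiv : ∀ c → (Σ (Word m N) λ u → C u × c ≡ x +ᵥ u) ⇔ c ~ x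
    equiv c = mk⇔ (λ { (u , cu , refl) → subst C (sym ([x+y]-x≡y x u)) cu })
                  (λ c~x → c +ᵥ -ᵥ x , c~x , sym (x+[y-x]≡y x c))

  ·~𝟎⇒∣⇒·~𝟎 : ∀ {p o x} → p · x ~ 𝟎 N → p ∣ o → o · x ~ 𝟎 N
  ·~𝟎⇒∣⇒·~𝟎 {p} {x = x} px~𝟎 (divides c refl) = ~-trans (≡⇒~ (·-* c p x)) (~-trans (~-· c px~𝟎) (≡⇒~ (·𝟎 N c)))

  ·~·% : ∀ {p x} .{{_ : NonZero p}} → p · x ~ 𝟎 N → ∀ i → i · x ~ (i % p) · x
  ·~·% {p} {x} px~𝟎 i = subst (_~ (i % p) · x) (sym split) (+-~ˡ (~𝟎⇒∈ (·~𝟎⇒∣⇒·~𝟎 px~𝟎 (n∣m*n (i / p)))))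
    where
    split : i · x ≡ (i % p) · x +ᵥ (i / p * p) · x
    split = trans (cong (_· x) (m≡m%n+[m/n]*n i p)) (·-+ (i % p) _ x)

module DualProperties (m : ℕ) {N} {C : Code m N} where

  open Words m

  Dual-𝟎 : Dual m N C (𝟎 N)
  Dual-𝟎 u _ = trans (dot-comm u _) (dot-𝟎ˡ u)

  Dual-+ : ∀ {u v} → Dual m N C u → Dual m N C v → Dual m N C (u +ᵥ v)
  Dual-+ {u} {v} du dv w cw = trans (dot-+ʳ w u v) (trans (cong₂ (addₘ m) (du w cw) (dv w cw)) (Zm.+-identityˡ _))

  Dual-neg : ∀ {u} → Dual m N C u → Dual m N C (-ᵥ u)
  Dual-neg {u} du w cw = trans (dot-comm w _) (trans (dot-negˡ u w) (trans (cong ⊖_ (trans (dot-comm u w) (du w cw))) Zmᴾ.-0#≈0#))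

  Dual-isCode : IsCode m N (Dual m N C)
  Dual-isCode = Dual-𝟎 , (λ _ _ → Dual-+) , (λ _ → Dual-neg)

module SpanProperties (m : ℕ) {N} {A : Code m N} where

  open Words m

  Span-isCode : IsCode m N (Span m N A)
  Span-isCode = zer , (λ _ _ → plus) , (λ _ → neg)

  Span-minimal : ∀ {D : Code m N} → IsCode m N D → (∀ v → A v → D v) → ∀ {v} → Span m N A v → D v
  Span-minimal isD A⊆D (gen a)    = A⊆D _ a
  Span-minimal isD A⊆D zer        = proj₁ isD
  Span-minimal isD A⊆D (plus u v) = proj₁ (proj₂ isD) _ _ (Span-minimal isD A⊆D u) (Span-minimal isD A⊆D v)
  Span-minimal isD A⊆D (neg u)    = proj₂ (proj₂ isD) _ (Span-minimal isD A⊆D u)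

  Span-selfOrthogonal : (∀ u v → A u → A v → ⟨ u , v ⟩ ≡ 𝟘) → SelfOrthogonal m N (Span m N A)
  Span-selfOrthogonal A-orth u u∈Span = Span-minimal (DualProperties.Dual-isCode m) A⊆Span⊥ u∈Span
    where
    Span⊆A⊥ : ∀ {v} → Span m N A v → Dual m N A v
    Span⊆A⊥ = Span-minimal (DualProperties.Dual-isCode m) (λ v Av w Aw → A-orth w v Aw Av)
    A⊆Span⊥ : ∀ v → A v → Dual m N (Span m N A) v
    A⊆Span⊥ v Av w w∈Span = trans (dot-comm w v) (Span⊆A⊥ w∈Span v Av)

least-positive : (Q : ℕ → Set) → (∀ j → Dec (Q j)) → ∀ B → Q (suc B) →
                 Σ ℕ λ d → Q (suc d) × (∀ j → j < d → ¬ Q (suc j))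
least-positive Q Q? B QB
  with Fin.¬∀⟶∃¬-smallest (suc B) (λ i → ¬ Q (suc (toℕ i))) (λ i → ¬? (Q? _))
         (λ ∀¬Q → ∀¬Q (fromℕ B) (subst (Q ∘ suc) (sym (Fin.toℕ-fromℕ B)) QB))
... | i , ¬¬Q , below = toℕ i , decidable-stable (Q? _) ¬¬Q , λ j j<i →
        subst (¬_ ∘ Q ∘ suc) (trans (Fin.toℕ-inject (fromℕ< j<i)) (Fin.toℕ-fromℕ< j<i)) (below (fromℕ< j<i))

module Counting (m : ℕ) where

  open Words m

  ∃-word? : ∀ {n} (P : Word m n → Set) → (∀ v → Dec (P v)) → Dec (Σ (Word m n) P)
  ∃-word? {zero}  P P? = map′ ([] ,_) (λ { ([] , p) → p }) (P? [])
  ∃-word? {suc n} P P? = map′ (λ (x , y , p) → x ∷ y , p) (λ { (x ∷ y , p) → x , y , p })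
                              (Fin.any? λ x → ∃-word? (P ∘ (x ∷_)) (P? ∘ (x ∷_)))

  -- With d the least positive first coordinate of a word of C and e = 2^m / d, one has C ≅ Fin e × K
  -- (lift) and C⊥ ≅ K⊥ × Fin d (extend), for the shortened code K; hence |C| |C⊥| = 2^m |K| |K⊥|.
  module Shortening {n} (C : Code m (suc n)) (isC : IsCode m (suc n) C) (C? : ∀ v → Dec (C v)) where

    open CodeProperties m C isC

    K : Code m n
    K y = C (𝟘 ∷ y)

    K-isCode : IsCode m n K
    K-isCode = C-𝟎
             , (λ u v ku kv → subst (λ x → C (x ∷ u +ᵥ v)) (Zm.+-identityˡ 𝟘) (C-+ ku kv))
             , (λ u ku → subst (λ x → C (x ∷ -ᵥ u)) Zmᴾ.-0#≈0# (C-neg ku))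

    Leads : ℕ → Set
    Leads j = Σ (Word m n) λ y → C (ι j ∷ y)

    Leads-M : Leads M
    Leads-M = 𝟎 n , subst (λ x → C (x ∷ 𝟎 n)) (sym ι-M) C-𝟎

    opaque
      least : Σ ℕ λ d → Leads (suc d) × (∀ j → j < d → ¬ Leads (suc j))
      least = least-positive Leads (λ j → ∃-word? _ (C? ∘ (ι j ∷_))) (M ∸ 1)
                (subst Leads (sym (ℕ.suc-pred M)) Leads-M)

    d : ℕ
    d = suc (proj₁ least)

    y₀ : Word m n
    y₀ = proj₁ (proj₁ (proj₂ least))

    g : Word m (suc n)
    g = ι d ∷ y₀

    g∈C : C g
    g∈C = proj₂ (proj₁ (proj₂ least))

    ·g : ∀ q → q · g ≡ ι (q * d) ∷ q · y₀
    ·g q = cong (_∷ q · y₀) (ι-* q d)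

    minus-·g : ∀ q {x y} → C (x ∷ y) → C (x ⊕ ⊖ ι (q * d) ∷ y +ᵥ -ᵥ q · y₀)
    minus-·g q {x} {y} c = subst C (cong (λ w → (x ∷ y) +ᵥ -ᵥ w) (·g q)) (C-+ c (C-neg (C-· q g∈C)))

    d-minimal : ∀ r → .{{NonZero r}} → r < d → ¬ Leads r
    d-minimal (suc r) (s≤s r<d) = proj₂ (proj₂ least) r r<d

    d∣Leads : ∀ a → Leads a → d ∣ a
    d∣Leads a (y , c) with a % d ℕ.≟ 0
    ... | yes r≡0 = m%n≡0⇒n∣m a d r≡0
    ... | no  r≢0 = ⊥-elim (d-minimal r {{ℕ.≢-nonZero r≢0}} (m%n<n a d)
                      (_ , subst (λ x → C (x ∷ y +ᵥ -ᵥ (a / d) · y₀)) r-lead (minus-·g (a / d) c)))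
      where
      r = a % d
      r-lead : ι a ⊕ ⊖ ι (a / d * d) ≡ ι r
      r-lead = begin
        ι a ⊕ ⊖ ι (a / d * d)                  ≡⟨ cong (λ w → ι w ⊕ ⊖ ι (a / d * d)) (m≡m%n+[m/n]*n a d) ⟩
        ι (r + a / d * d) ⊕ ⊖ ι (a / d * d)    ≡⟨ cong (_⊕ ⊖ ι (a / d * d)) (ι-+ r _) ⟨
        (ι r ⊕ ι (a / d * d)) ⊕ ⊖ ι (a / d * d) ≡⟨ Zmᴾ.//-rightDividesʳ (ι (a / d * d)) (ι r) ⟩
        ι r                                    ∎
        where open ≡-Reasoning

    d∣M : d ∣ M
    d∣M = d∣Leads M Leads-M

    e : ℕ
    e = M / d

    e*d≡M : e * d ≡ M
    e*d≡M = m/n*n≡m d∣M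

    instance
      e-nonZero : NonZero e
      e-nonZero = ℕ.≢-nonZero λ e≡0 → ℕ.≢-nonZero⁻¹ M (trans (sym e*d≡M) (cong (_* d) e≡0))

    q*d<M : ∀ {q} → q < e → q * d < M
    q*d<M {q} q<e = subst (q * d <_) e*d≡M (ℕ.*-monoˡ-< d q<e)

    decompose : ∀ {x y} → C (x ∷ y) → Σ ℕ λ q → q < e × x ≡ ι (q * d) × K (y +ᵥ -ᵥ q · y₀)
    decompose {x} {y} c = q , q<e , x≡ , subst (λ w → C (w ∷ y +ᵥ -ᵥ q · y₀)) x-x≡𝟘 (minus-·g q c)
      where
      d∣x : d ∣ toℕ x
      d∣x = d∣Leads (toℕ x) (y , subst (λ w → C (w ∷ y)) (sym (ι-toℕ x)) c)
      q = toℕ x / d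
      x≡ : x ≡ ι (q * d)
      x≡ = trans (sym (ι-toℕ x)) (cong ι (sym (m/n*n≡m d∣x)))
      q<e : q < e
      q<e = ℕ.*-cancelʳ-< d q e (subst₂ _<_ (sym (m/n*n≡m d∣x)) (sym e*d≡M) (Fin.toℕ<n x))
      x-x≡𝟘 : x ⊕ ⊖ ι (q * d) ≡ 𝟘
      x-x≡𝟘 = trans (cong (λ w → x ⊕ ⊖ w) (sym x≡)) (Zm.-‿inverseʳ x)

    lift : Fin e → Word m n → Word m (suc n)
    lift q y = ι (toℕ q * d) ∷ toℕ q · y₀ +ᵥ y

    lift-injective : ∀ {q q′ y y′} → lift q y ≡ lift q′ y′ → q ≡ q′ × y ≡ y′
    lift-injective {q} {q′} {y} {y′} eq = q≡q′ , Wᴾ.∙-cancelˡ (toℕ q · y₀) y y′ tails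
      where
      q≡q′ : q ≡ q′
      q≡q′ = Fin.toℕ-injective (ℕ.*-cancelʳ-≡ (toℕ q) (toℕ q′) d
               (ι-injective-< (q*d<M (Fin.toℕ<n q)) (q*d<M (Fin.toℕ<n q′)) (Vec.∷-injectiveˡ eq)))
      tails : toℕ q · y₀ +ᵥ y ≡ toℕ q · y₀ +ᵥ y′
      tails = trans (Vec.∷-injectiveʳ eq) (cong (λ i → toℕ i · y₀ +ᵥ y′) (sym q≡q′))

    size-C : ∀ {a} → Size K a → Size C (e * a)
    size-C sizeK = size-resp equiv (size-product lift lift-injective (size-Fin e) sizeK)
      where
      equiv : ∀ v → (Σ (Fin e) λ q → Σ (Word m n) λ y → ⊤ × K y × v ≡ lift q y) ⇔ C v
      equiv v = mk⇔ (λ { (q , y , _ , ky , refl) → subst C (lift≡ q y) (C-+ (C-· (toℕ q) g∈C) ky) }) (unlift v)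
        where
        lift≡ : ∀ q y → toℕ q · g +ᵥ (𝟘 ∷ y) ≡ lift q y
        lift≡ q y = cong₂ _∷_ (trans (cong (_⊕ 𝟘) (ι-* (toℕ q) d)) (Zm.+-identityʳ _)) refl
        unlift : ∀ v → C v → Σ (Fin e) λ q → Σ (Word m n) λ y → ⊤ × K y × v ≡ lift q y
        unlift (x ∷ y) c with decompose c
        ... | q , q<e , refl , k = fromℕ< q<e , y +ᵥ -ᵥ q · y₀ , tt , k ,
                cong₂ (λ i z → ι (i * d) ∷ z) (sym (Fin.toℕ-fromℕ< q<e))
                  (sym (trans (cong (λ i → i · y₀ +ᵥ (y +ᵥ -ᵥ q · y₀)) (Fin.toℕ-fromℕ< q<e)) (x+[y-x]≡y (q · y₀) y)))

    dual-∷⇔ : ∀ a z → Dual m (suc n) C (a ∷ z) ⇔ (Dual m n K z × ι d ⊗ a ≡ ⊖ ⟨ y₀ , z ⟩)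
    dual-∷⇔ a z = mk⇔ (λ dv → dual-K dv , Zmᴾ.+-inverseˡ-unique _ _ (dv g g∈C)) dual-C
      where
      dual-K : Dual m (suc n) C (a ∷ z) → Dual m n K z
      dual-K dv y ky = trans (sym (trans (cong (_⊕ ⟨ y , z ⟩) (Zm.zeroˡ a)) (Zm.+-identityˡ _))) (dv (𝟘 ∷ y) ky)
      dual-C : Dual m n K z × ι d ⊗ a ≡ ⊖ ⟨ y₀ , z ⟩ → Dual m (suc n) C (a ∷ z)
      dual-C (dz , da) (x ∷ y) c with decompose c
      ... | q , _ , refl , k = begin
        ι (q * d) ⊗ a ⊕ ⟨ y , z ⟩
          ≡⟨ cong₂ (λ u w → u ⊗ a ⊕ ⟨ w , z ⟩) (ι-* q d) (x+[y-x]≡y (q · y₀) y) ⟨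
        ι q ⊗ ι d ⊗ a ⊕ ⟨ q · y₀ +ᵥ (y +ᵥ -ᵥ q · y₀) , z ⟩
          ≡⟨ cong₂ _⊕_ (Zm.*-assoc (ι q) (ι d) a) (dot-+ˡ (q · y₀) _ z) ⟩
        ι q ⊗ (ι d ⊗ a) ⊕ (⟨ q · y₀ , z ⟩ ⊕ ⟨ y +ᵥ -ᵥ q · y₀ , z ⟩)
          ≡⟨ cong₂ (λ u w → ι q ⊗ u ⊕ (⟨ q · y₀ , z ⟩ ⊕ w)) da (dz _ k) ⟩
        ι q ⊗ ⊖ ⟨ y₀ , z ⟩ ⊕ (⟨ q · y₀ , z ⟩ ⊕ 𝟘)
          ≡⟨ cong₂ _⊕_ (sym (Zmᴾ.-‿distribʳ-* (ι q) _)) (trans (Zm.+-identityʳ _) (dot-·ˡ q y₀ z)) ⟩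
        ⊖ (ι q ⊗ ⟨ y₀ , z ⟩) ⊕ ι q ⊗ ⟨ y₀ , z ⟩
          ≡⟨ Zm.-‿inverseˡ _ ⟩
        𝟘 ∎
        where open ≡-Reasoning

    d∣⟨y₀,-⟩ : ∀ z → Dual m n K z → d ∣ toℕ ⟨ y₀ , z ⟩
    d∣⟨y₀,-⟩ z dz = *-cancelˡ-∣ e (subst (_∣ e * toℕ ⟨ y₀ , z ⟩) (sym e*d≡M) (ι≡𝟘⇒M∣ e·⟨y₀,z⟩≡𝟘))
      where
      e·y₀∈K : K (e · y₀)
      e·y₀∈K = subst C (trans (·g e) (cong (_∷ e · y₀) (trans (cong ι e*d≡M) ι-M))) (C-· e g∈C)
      e·⟨y₀,z⟩≡𝟘 : ι (e * toℕ ⟨ y₀ , z ⟩) ≡ 𝟘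
      e·⟨y₀,z⟩≡𝟘 = trans (sym (ι-⊗ e _)) (trans (sym (dot-·ˡ e y₀ z)) (dz _ e·y₀∈K))

    -- By dual-∷⇔, a ∷ z ∈ C⊥ iff z ∈ K⊥ and ι d ⊗ a ≡ ⊖ ⟨ y₀ , z ⟩; a₀ z is one solution, the others being
    -- a₀ z ⊕ ι (j * e) with j < d (annihilator).
    a₀ : Word m n → Zm m
    a₀ z = ⊖ ι (toℕ ⟨ y₀ , z ⟩ / d)

    d·a₀ : ∀ z → Dual m n K z → ι d ⊗ a₀ z ≡ ⊖ ⟨ y₀ , z ⟩
    d·a₀ z dz = begin
      ι d ⊗ ⊖ ι (w / d)    ≡⟨ Zmᴾ.-‿distribʳ-* (ι d) _ ⟨
      ⊖ (ι d ⊗ ι (w / d))  ≡⟨ cong ⊖_ (trans (ι-* d (w / d)) (cong ι (m*[n/m]≡n (d∣⟨y₀,-⟩ z dz)))) ⟩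
      ⊖ ι w                ≡⟨ cong ⊖_ (ι-toℕ _) ⟩
      ⊖ ⟨ y₀ , z ⟩          ∎
      where
      open ≡-Reasoning
      w = toℕ ⟨ y₀ , z ⟩

    j*e<M : ∀ {j} → j < d → j * e < M
    j*e<M {j} j<d = subst (j * e <_) (trans (ℕ.*-comm d e) e*d≡M) (ℕ.*-monoˡ-< e j<d)

    d·ι[j*e]≡𝟘 : ∀ j → ι d ⊗ ι (j * e) ≡ 𝟘
    d·ι[j*e]≡𝟘 j = trans (ι-* d (j * e)) (ι-cong (trans (cong (_% M) d*[j*e]≡j*M) (trans (m*n%n≡0 j M) (sym 0%M≡0))))
      where
      d*[j*e]≡j*M : d * (j * e) ≡ j * M
      d*[j*e]≡j*M = trans (sym (ℕ.*-assoc d j e)) (trans (cong (_* e) (ℕ.*-comm d j))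
                      (trans (ℕ.*-assoc j d e) (cong (j *_) (trans (ℕ.*-comm d e) e*d≡M))))

    annihilator : ∀ b → ι d ⊗ b ≡ 𝟘 → Σ ℕ λ j → j < d × b ≡ ι (j * e)
    annihilator b db≡𝟘 = j , j<d , trans (sym (ι-toℕ b)) (cong ι (sym (m/n*n≡m e∣b)))
      where
      e∣b : e ∣ toℕ b
      e∣b = *-cancelˡ-∣ d (subst (_∣ d * toℕ b) (trans (sym e*d≡M) (ℕ.*-comm e d)) (ι≡𝟘⇒M∣ (trans (sym (ι-⊗ d b)) db≡𝟘)))
      j = toℕ b / e
      j<d : j < d
      j<d = ℕ.*-cancelʳ-< e j d (subst₂ _<_ (sym (m/n*n≡m e∣b)) (trans (sym e*d≡M) (ℕ.*-comm e d)) (Fin.toℕ<n b))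

    extend : Word m n → Fin d → Word m (suc n)
    extend z j = a₀ z ⊕ ι (toℕ j * e) ∷ z

    extend-injective : ∀ {z z′ j j′} → extend z j ≡ extend z′ j′ → z ≡ z′ × j ≡ j′
    extend-injective {z} {z′} {j} {j′} eq = z≡z′ , j≡j′
      where
      z≡z′ = Vec.∷-injectiveʳ eq
      heads : a₀ z ⊕ ι (toℕ j * e) ≡ a₀ z ⊕ ι (toℕ j′ * e)
      heads = trans (Vec.∷-injectiveˡ eq) (cong (λ w → a₀ w ⊕ ι (toℕ j′ * e)) (sym z≡z′))
      j≡j′ = Fin.toℕ-injective (ℕ.*-cancelʳ-≡ (toℕ j) (toℕ j′) e
               (ι-injective-< (j*e<M (Fin.toℕ<n j)) (j*e<M (Fin.toℕ<n j′)) (Zmᴾ.+-cancelˡ (a₀ z) _ _ heads)))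

    d·[a₀+ι[j*e]] : ∀ z j → Dual m n K z → ι d ⊗ (a₀ z ⊕ ι (j * e)) ≡ ⊖ ⟨ y₀ , z ⟩
    d·[a₀+ι[j*e]] z j dz = begin
      ι d ⊗ (a₀ z ⊕ ι (j * e))         ≡⟨ Zm.distribˡ (ι d) _ _ ⟩
      ι d ⊗ a₀ z ⊕ ι d ⊗ ι (j * e)     ≡⟨ cong₂ _⊕_ (d·a₀ z dz) (d·ι[j*e]≡𝟘 j) ⟩
      ⊖ ⟨ y₀ , z ⟩ ⊕ 𝟘                  ≡⟨ Zm.+-identityʳ _ ⟩
      ⊖ ⟨ y₀ , z ⟩                      ∎
      where open ≡-Reasoning

    a≡a₀+ι[j*e] : ∀ a z → Dual m n K z → ι d ⊗ a ≡ ⊖ ⟨ y₀ , z ⟩ → Σ (Fin d) λ j → a ≡ a₀ z ⊕ ι (toℕ j * e)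
    a≡a₀+ι[j*e] a z dz da = fromℕ< j<d , (begin
      a                          ≡⟨ Zmᴾ.\\-leftDividesˡ (a₀ z) a ⟨
      a₀ z ⊕ (⊖ a₀ z ⊕ a)        ≡⟨ cong (a₀ z ⊕_) (trans (Zm.+-comm _ a) a-a₀≡) ⟩
      a₀ z ⊕ ι (j * e)           ≡⟨ cong (λ i → a₀ z ⊕ ι (i * e)) (Fin.toℕ-fromℕ< j<d) ⟨
      a₀ z ⊕ ι (toℕ (fromℕ< j<d) * e) ∎)
      where
      open ≡-Reasoning
      d·[a-a₀]≡𝟘 : ι d ⊗ (a ⊕ ⊖ a₀ z) ≡ 𝟘
      d·[a-a₀]≡𝟘 = begin
        ι d ⊗ (a ⊕ ⊖ a₀ z)          ≡⟨ Zmᴾ.x[y-z]≈xy-xz (ι d) a (a₀ z) ⟩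
        ι d ⊗ a ⊕ ⊖ (ι d ⊗ a₀ z)    ≡⟨ cong (λ w → ι d ⊗ a ⊕ ⊖ w) (trans (d·a₀ z dz) (sym da)) ⟩
        ι d ⊗ a ⊕ ⊖ (ι d ⊗ a)       ≡⟨ Zm.-‿inverseʳ _ ⟩
        𝟘                           ∎
      j = proj₁ (annihilator _ d·[a-a₀]≡𝟘)
      j<d = proj₁ (proj₂ (annihilator _ d·[a-a₀]≡𝟘))
      a-a₀≡ = proj₂ (proj₂ (annihilator _ d·[a-a₀]≡𝟘))

    size-dual : ∀ {b} → Size (Dual m n K) b → Size (Dual m (suc n) C) (b * d)
    size-dual sizeK⊥ = size-resp equiv (size-product extend extend-injective sizeK⊥ (size-Fin d))
      where
      unextend : ∀ a z → Dual m (suc n) C (a ∷ z) →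
                 Σ (Word m n) λ z′ → Σ (Fin d) λ j → Dual m n K z′ × ⊤ × a ∷ z ≡ extend z′ j
      unextend a z dv = z , proj₁ a≡ , dz , tt , cong (_∷ z) (proj₂ a≡)
        where
        dz = proj₁ (to (dual-∷⇔ a z) dv)
        a≡ = a≡a₀+ι[j*e] a z dz (proj₂ (to (dual-∷⇔ a z) dv))
      equiv : ∀ v → (Σ (Word m n) λ z → Σ (Fin d) λ j → Dual m n K z × ⊤ × v ≡ extend z j) ⇔ Dual m (suc n) C v
      equiv (a ∷ z) = mk⇔ (λ { (z , j , dz , _ , refl) → from (dual-∷⇔ _ z) (dz , d·[a₀+ι[j*e]] z (toℕ j) dz) })
                          (unextend a z)

  size*size-dual : ∀ n (C : Code m n) → IsCode m n C → (∀ v → Dec (C v)) →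
                   Σ ℕ λ a → Σ ℕ λ b → Size C a × Size (Dual m n C) b × a * b ≡ M ^ n
  size*size-dual zero C isC C? = 1 , 1 , size-resp only-[]∈C (size-singleton []) , size-resp only-[]∈C⊥ (size-singleton []) , refl
    where
    only-[]∈C : ∀ v → v ≡ [] ⇔ C v
    only-[]∈C [] = mk⇔ (λ _ → proj₁ isC) (λ _ → refl)
    only-[]∈C⊥ : ∀ v → v ≡ [] ⇔ Dual m zero C v
    only-[]∈C⊥ [] = mk⇔ (λ { _ [] _ → refl }) (λ _ → refl)
  size*size-dual (suc n) C isC C?
    with size*size-dual n (Shortening.K C isC C?) (Shortening.K-isCode C isC C?) (C? ∘ (𝟘 ∷_))
  ... | a , b , sizeK , sizeK⊥ , a*b≡ = e * a , b * d , size-C sizeK , size-dual sizeK⊥ , (begin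
    e * a * (b * d)  ≡⟨ ℕ.*-assoc e a (b * d) ⟩
    e * (a * (b * d)) ≡⟨ cong (e *_) (trans (sym (ℕ.*-assoc a b d)) (ℕ.*-comm (a * b) d)) ⟩
    e * (d * (a * b)) ≡⟨ sym (ℕ.*-assoc e d (a * b)) ⟩
    e * d * (a * b)  ≡⟨ cong₂ _*_ e*d≡M a*b≡ ⟩
    M * M ^ n        ∎)
    where
    open Shortening C isC C?
    open ≡-Reasoning

  _≟ᵥ_ : ∀ {n} → DecidableEquality (Word m n)
  _≟ᵥ_ = Vec.≡-dec Fin._≟_

  dual-size : ∀ {n} {C : Code m n} {a} → IsCode m n C → Size C a → Σ ℕ λ b → Size (Dual m n C) b × a * b ≡ M ^ n
  dual-size {n} {C} isC sizeC with size*size-dual n C isC (WithDecidableEquality.size-dec _≟ᵥ_ sizeC)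
  ... | a′ , b , sizeC′ , sizeC⊥ , a′*b≡ = b , sizeC⊥ , trans (cong (_* b) (size-unique sizeC sizeC′ (λ _ → mk⇔ id id))) a′*b≡

square-of-double : ∀ c → (c * 2) * (c * 2) ≡ 2 * (2 * (c * c))
square-of-double = solve 1 (λ c → (c :* con 2) :* (c :* con 2) := con 2 :* (con 2 :* (c :* c))) refl
  where open +-*-Solver

even-square≡2^ : ∀ k b → b * b ≡ 2 ^ suc k → Σ ℕ λ c → b ≡ 2 * c × 2 * (c * c) ≡ 2 ^ k
even-square≡2^ k b eq with reduce (euclidsLemma b b prime[2] (divides (2 ^ k) (trans eq (ℕ.*-comm 2 (2 ^ k)))))
... | divides c refl = c , ℕ.*-comm c 2 , ℕ.*-cancelˡ-≡ _ _ 2 (trans (sym (square-of-double c)) eq)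

square≡2^⇒ : ∀ k b → b * b ≡ 2 ^ k → Σ ℕ λ i → k ≡ i + i × b ≡ 2 ^ i
square≡2^⇒ zero          b eq = 0 , refl , ℕ.m*n≡1⇒n≡1 b b eq
square≡2^⇒ (suc zero)    b eq with even-square≡2^ 0 b eq
... | c , _ , 2c²≡1 = ⊥-elim (ℕ.even≢odd (c * c) 0 2c²≡1)
square≡2^⇒ (suc (suc k)) b eq with even-square≡2^ (suc k) b eq
... | c , refl , 2c²≡ with square≡2^⇒ k c (ℕ.*-cancelˡ-≡ _ _ 2 2c²≡)
...   | i , refl , refl = suc i , cong suc (sym (ℕ.+-suc i i)) , refl

∣suc+[∸suc]⇒≡ : ∀ {o x y} .{{_ : NonZero o}} → x < o → y < o → o ∣ suc x + (o ∸ suc y) → x ≡ y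
∣suc+[∸suc]⇒≡ {o} {x} {y} x<o y<o o∣X = begin
  x                              ≡⟨ m<n⇒m%n≡m x<o ⟨
  x % o                          ≡⟨ [m+n]%n≡m%n x o ⟨
  (x + o) % o                    ≡⟨ cong (_% o) X+y≡x+o ⟨
  (suc x + (o ∸ suc y) + y) % o  ≡⟨ %-remove-+ˡ y o∣X ⟩
  y % o                          ≡⟨ m<n⇒m%n≡m y<o ⟩
  y                              ∎
  where
  open ≡-Reasoning
  shuffle : ∀ x z y → suc x + z + y ≡ x + (z + suc y)
  shuffle = solve 3 (λ x z y → con 1 :+ x :+ z :+ y := x :+ (z :+ (con 1 :+ y))) refl
    where open +-*-Solver
  X+y≡x+o : suc x + (o ∸ suc y) + y ≡ x + o
  X+y≡x+o = trans (shuffle x (o ∸ suc y) y) (cong (x +_) (ℕ.m∸n+n≡m y<o))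

positive-residue : ∀ o .{{_ : NonZero o}} i → Σ ℕ λ i′ → Σ ℕ λ c → 1 ≤ i′ × i′ ≤ o × i + o ≡ i′ + c * o
positive-residue o i with i % o ℕ.≟ 0
... | yes i%o≡0 = o , i / o , ℕ.>-nonZero⁻¹ o , ℕ.≤-refl ,
        trans (cong (_+ o) (trans (m≡m%n+[m/n]*n i o) (cong (_+ i / o * o) i%o≡0))) (ℕ.+-comm (i / o * o) o)
... | no  i%o≢0 = i % o , suc (i / o) , ℕ.n≢0⇒n>0 i%o≢0 , ℕ.<⇒≤ (m%n<n i o) ,
        trans (cong (_+ o) (m≡m%n+[m/n]*n i o)) (trans (ℕ.+-assoc (i % o) _ o) (cong (i % o +_) (ℕ.+-comm (i / o * o) o)))

module IndexTwo {m n} (C C₀ : Code m n) (isC : IsCode m n C) (sdC : SelfDual m n C)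
  (isC₀ : IsCode m n C₀) (C₀⊆C : Subcode m n C₀ C) {a b} (sizeC₀ : HasSize m n C₀ a) (sizeC : HasSize m n C b)
  (b≡2a : b ≡ 2 * a) {t s} (t∈C : C t) (t∉C₀ : ¬ C₀ t) (s∈C₀⊥ : Dual m n C₀ s) (s∉C : ¬ C s) where

  open Words m
  open Counting m
  open CodeProperties m C₀ isC₀
  open DualProperties m
  module Cᴾ = CodeProperties m C isC

  b*b≡M^n : b * b ≡ M ^ n
  b*b≡M^n with dual-size isC sizeC
  ... | b′ , sizeC⊥ , b*b′≡ = trans (cong (b *_) (size-unique sizeC sizeC⊥ sdC)) b*b′≡

  1≤a : 1 ≤ a
  1≤a = size-nonempty (𝟎 n) C-𝟎 sizeC₀

  a≡2^ : a ≡ 2 ^ (m * n / 2 ∸ 1)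
  a≡2^ with square≡2^⇒ (m * n) b (trans b*b≡M^n (ℕ.^-*-assoc 2 m n))
  ... | zero  , _ , b≡1 = ⊥-elim (ℕ.<-irrefl (trans (sym b≡1) b≡2a) (ℕ.*-monoʳ-≤ 2 1≤a))
  ... | suc i , mn≡ , b≡ = ℕ.*-cancelˡ-≡ a _ 2 (trans (sym b≡2a) (trans b≡ (cong (λ j → 2 * 2 ^ j) i≡)))
    where
    double : suc i + suc i ≡ suc i * 2
    double = trans (cong (suc i +_) (sym (ℕ.+-identityʳ (suc i)))) (ℕ.*-comm 2 (suc i))
    i≡ : i ≡ m * n / 2 ∸ 1
    i≡ = sym (cong (_∸ 1) (trans (cong (_/ 2) (trans mn≡ double)) (m*n/n≡m (suc i) 2)))

  size-C₀⊥ : Size (Dual m n C₀) ((a + a) + (a + a))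
  size-C₀⊥ with dual-size isC₀ sizeC₀
  ... | d , sizeC₀⊥ , a*d≡M^n = subst (Size (Dual m n C₀)) d≡4a sizeC₀⊥
    where
    instance _ = ℕ.>-nonZero 1≤a
    d≡4a : d ≡ (a + a) + (a + a)
    d≡4a = ℕ.*-cancelˡ-≡ d _ a (trans a*d≡M^n (trans (sym b*b≡M^n) (trans (cong₂ _*_ b≡2a b≡2a) (4a² a))))
      where
      open +-*-Solver
      4a² : ∀ a → 2 * a * (2 * a) ≡ a * ((a + a) + (a + a))
      4a² = solve 1 (λ a → con 2 :* a :* (con 2 :* a) := a :* ((a :+ a) :+ (a :+ a))) refl

  ~-C : ∀ {x y} → x ~ y → C x → C y
  ~-C {x} {y} x~y cx = subst C x-[x-y]≡y (Cᴾ.C-+ cx (Cᴾ.C-neg (C₀⊆C _ x~y)))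
    where
    x-[x-y]≡y : x +ᵥ -ᵥ (x +ᵥ -ᵥ y) ≡ y
    x-[x-y]≡y = trans (cong (x +ᵥ_) (Wᴾ.⁻¹-anti-homo‿- x y)) (x+[y-x]≡y x y)

  [s+t]-t≡s : s +ᵥ t +ᵥ -ᵥ t ≡ s
  [s+t]-t≡s = trans (cong (_+ᵥ -ᵥ t) (W.comm s t)) ([x+y]-x≡y t s)

  s+t∉C : ¬ C (s +ᵥ t)
  s+t∉C s+t∈C = s∉C (subst C [s+t]-t≡s (Cᴾ.C-+ s+t∈C (Cᴾ.C-neg t∈C)))

  t≁𝟎 : ¬ t ~ 𝟎 n
  t≁𝟎 = t∉C₀ ∘ ~𝟎⇒∈

  s≁𝟎 : ¬ s ~ 𝟎 n
  s≁𝟎 = s∉C ∘ C₀⊆C _ ∘ ~𝟎⇒∈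

  s+t≁𝟎 : ¬ s +ᵥ t ~ 𝟎 n
  s+t≁𝟎 = s+t∉C ∘ C₀⊆C _ ∘ ~𝟎⇒∈

  s≁t : ¬ s ~ t
  s≁t s~t = s∉C (~-C (~-sym s~t) t∈C)

  s+t≁t : ¬ s +ᵥ t ~ t
  s+t≁t p = s∉C (C₀⊆C _ (subst C₀ [s+t]-t≡s p))

  s+t≁s : ¬ s +ᵥ t ~ s
  s+t≁s p = t∉C₀ (~𝟎⇒∈ (~-cancelˡ (subst (s +ᵥ t ~_) (sym (W.identityʳ s)) p)))

  open WithDecidableEquality (_≟ᵥ_ {n}) using (size-cover)

  C-cover : ∀ c → C c → c ~ 𝟎 n ⊎ c ~ t
  C-cover = size-cover two-cosets (subst (Size C) b≡a+a sizeC) ⊆C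
    where
    b≡a+a : b ≡ a + a
    b≡a+a = trans b≡2a (cong (a +_) (ℕ.+-identityʳ a))
    two-cosets : Size (λ c → c ~ 𝟎 n ⊎ c ~ t) (a + a)
    two-cosets = size-⊎ (λ _ p q → t≁𝟎 (~-trans (~-sym q) p)) (coset-size (𝟎 n) sizeC₀) (coset-size t sizeC₀)
    ⊆C : ∀ c → c ~ 𝟎 n ⊎ c ~ t → C c
    ⊆C c (inj₁ c~𝟎) = C₀⊆C _ (~𝟎⇒∈ c~𝟎)
    ⊆C c (inj₂ c~t) = ~-C (~-sym c~t) t∈C

  C₀⊆C₀⊥ : ∀ {u} → C₀ u → Dual m n C₀ u
  C₀⊆C₀⊥ {u} u∈C₀ w w∈C₀ = to (sdC u) (C₀⊆C u u∈C₀) w (C₀⊆C w w∈C₀)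

  t∈C₀⊥ : Dual m n C₀ t
  t∈C₀⊥ w w∈C₀ = to (sdC t) t∈C w (C₀⊆C w w∈C₀)

  Dual-~ : ∀ {c x} → c ~ x → Dual m n C₀ x → Dual m n C₀ c
  Dual-~ {c} {x} c~x x∈C₀⊥ = subst (Dual m n C₀) (x+[y-x]≡y x c) (Dual-+ x∈C₀⊥ (C₀⊆C₀⊥ c~x))

  C₀⊥-cover : ∀ c → Dual m n C₀ c → (c ~ 𝟎 n ⊎ c ~ t) ⊎ (c ~ s ⊎ c ~ s +ᵥ t)
  C₀⊥-cover = size-cover four-cosets size-C₀⊥ ⊆C₀⊥
    where
    disjoint : ∀ c → c ~ 𝟎 n ⊎ c ~ t → c ~ s ⊎ c ~ s +ᵥ t → ⊥
    disjoint c (inj₁ p) (inj₁ q) = s≁𝟎 (~-trans (~-sym q) p)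
    disjoint c (inj₁ p) (inj₂ q) = s+t≁𝟎 (~-trans (~-sym q) p)
    disjoint c (inj₂ p) (inj₁ q) = s≁t (~-trans (~-sym q) p)
    disjoint c (inj₂ p) (inj₂ q) = s+t≁t (~-trans (~-sym q) p)
    four-cosets : Size (λ c → (c ~ 𝟎 n ⊎ c ~ t) ⊎ (c ~ s ⊎ c ~ s +ᵥ t)) ((a + a) + (a + a))
    four-cosets = size-⊎ disjoint
      (size-⊎ (λ _ p q → t≁𝟎 (~-trans (~-sym q) p)) (coset-size (𝟎 n) sizeC₀) (coset-size t sizeC₀))
      (size-⊎ (λ _ p q → s+t≁s (~-trans (~-sym q) p)) (coset-size s sizeC₀) (coset-size (s +ᵥ t) sizeC₀))
    ⊆C₀⊥ : ∀ c → (c ~ 𝟎 n ⊎ c ~ t) ⊎ (c ~ s ⊎ c ~ s +ᵥ t) → Dual m n C₀ c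
    ⊆C₀⊥ c (inj₁ (inj₁ p)) = Dual-~ p Dual-𝟎
    ⊆C₀⊥ c (inj₁ (inj₂ p)) = Dual-~ p t∈C₀⊥
    ⊆C₀⊥ c (inj₂ (inj₁ p)) = Dual-~ p s∈C₀⊥
    ⊆C₀⊥ c (inj₂ (inj₂ p)) = Dual-~ p (Dual-+ s∈C₀⊥ t∈C₀⊥)

  2·t~𝟎 : 2 · t ~ 𝟎 n
  2·t~𝟎 with C-cover (t +ᵥ t) (Cᴾ.C-+ t∈C t∈C)
  ... | inj₁ t+t~𝟎 = subst (_~ 𝟎 n) (sym (2·≡+ᵥ t)) t+t~𝟎
  ... | inj₂ t+t~t = ⊥-elim (t∉C₀ (subst C₀ ([x+y]-x≡y t t) t+t~t))

  2·s~𝟎 : IsQuotType m n C₀ klein → 2 · s ~ 𝟎 n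
  2·s~𝟎 klein-quotient = subst (_~ 𝟎 n) (sym (2·≡+ᵥ s)) (∈⇒~𝟎 (klein-quotient s s∈C₀⊥))

  -- if 2s ∈ C₀, then 2x ∈ C₀ for every x ∈ C₀⊥, so the quotient would be a Klein group
  2·s~t : IsQuotType m n C₀ cyclic → 2 · s ~ t
  2·s~t (x , x∈C₀⊥ , x+x∉C₀) with C₀⊥-cover (s +ᵥ s) (Dual-+ s∈C₀⊥ s∈C₀⊥)
  ... | inj₁ (inj₂ s+s~t)   = subst (_~ t) (sym (2·≡+ᵥ s)) s+s~t
  ... | inj₂ (inj₁ s+s~s)   = ⊥-elim (s∉C (C₀⊆C _ (subst C₀ ([x+y]-x≡y s s) s+s~s)))
  ... | inj₂ (inj₂ s+s~s+t) = ⊥-elim (s≁t (~-cancelˡ s+s~s+t))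
  ... | inj₁ (inj₁ s+s~𝟎)   = ⊥-elim (x+x∉C₀ (~𝟎⇒∈ (double (C₀⊥-cover x x∈C₀⊥))))
    where
    t+t~𝟎 = subst (_~ 𝟎 n) (2·≡+ᵥ t) 2·t~𝟎
    𝟎+𝟎~𝟎 = ≡⇒~ (W.identityˡ (𝟎 n))
    [s+t]+[s+t]~𝟎 = ~-trans (≡⇒~ (W⁺.interchange s t s t)) (~-trans (~-+ s+s~𝟎 t+t~𝟎) 𝟎+𝟎~𝟎)
    double : (x ~ 𝟎 n ⊎ x ~ t) ⊎ (x ~ s ⊎ x ~ s +ᵥ t) → x +ᵥ x ~ 𝟎 n
    double (inj₁ (inj₁ p)) = ~-trans (~-+ p p) 𝟎+𝟎~𝟎
    double (inj₁ (inj₂ p)) = ~-trans (~-+ p p) t+t~𝟎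
    double (inj₂ (inj₁ p)) = ~-trans (~-+ p p) s+s~𝟎
    double (inj₂ (inj₂ p)) = ~-trans (~-+ p p) [s+t]+[s+t]~𝟎

  4·s~𝟎 : IsQuotType m n C₀ cyclic → 4 · s ~ 𝟎 n
  4·s~𝟎 cyclic-quotient = ~-trans (≡⇒~ (·-* 2 2 s)) (~-trans (~-· 2 (2·s~t cyclic-quotient)) 2·t~𝟎)

  rep : ℕ → Word m n
  rep 0 = 𝟎 n
  rep 1 = s
  rep 2 = t
  rep 3 = s +ᵥ t
  rep _ = 𝟎 n

  Cᵢ⇔~rep : ∀ r → r < 4 → ∀ c → Cᵢ m n C₀ s t r c ⇔ c ~ rep r
  Cᵢ⇔~rep 0 _ c = mk⇔ ∈⇒~𝟎 ~𝟎⇒∈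
  Cᵢ⇔~rep 1 _ c = mk⇔ id id
  Cᵢ⇔~rep 2 _ c = mk⇔ id id
  Cᵢ⇔~rep 3 _ c = mk⇔ id id
  Cᵢ⇔~rep (suc (suc (suc (suc _)))) (s≤s (s≤s (s≤s (s≤s ())))) c

  klein-rep : ∀ i j → i < 2 → j < 2 → i · s +ᵥ j · t ~ rep (i + 2 * j)
  klein-rep 0 0 _ _ = ≡⇒~ (trans (cong₂ _+ᵥ_ (0· s) (0· t)) (W.identityˡ _))
  klein-rep 1 0 _ _ = ≡⇒~ (trans (cong₂ _+ᵥ_ (1· s) (0· t)) (W.identityʳ _))
  klein-rep 0 1 _ _ = ≡⇒~ (trans (cong₂ _+ᵥ_ (0· s) (1· t)) (W.identityˡ _))
  klein-rep 1 1 _ _ = ≡⇒~ (cong₂ _+ᵥ_ (1· s) (1· t))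
  klein-rep (suc (suc _)) _ (s≤s (s≤s ())) _
  klein-rep _ (suc (suc _)) _ (s≤s (s≤s ()))

  cyclic-rep : 2 · s ~ t → ∀ i → i < 4 → i · s ~ rep i
  cyclic-rep 2·s~t 0 _ = ≡⇒~ (0· s)
  cyclic-rep 2·s~t 1 _ = ≡⇒~ (1· s)
  cyclic-rep 2·s~t 2 _ = 2·s~t
  cyclic-rep 2·s~t 3 _ = ~-trans (≡⇒~ (suc· 2 s)) (~-+ ~-refl 2·s~t)
  cyclic-rep 2·s~t (suc (suc (suc (suc _)))) (s≤s (s≤s (s≤s (s≤s ()))))

  η<4 : ∀ q i j → η q i j < 4
  η<4 klein  i j = s≤s (ℕ.+-mono-≤ (ℕ.<⇒≤pred (m%n<n i 2)) (ℕ.*-monoʳ-≤ 2 (ℕ.<⇒≤pred (m%n<n j 2))))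
  η<4 cyclic i j = m%n<n (i + 2 * j) 4

  label : ∀ {q} → IsQuotType m n C₀ q → ∀ i j → i · s +ᵥ j · t ~ rep (η q i j)
  label {klein} klein-quotient i j =
    ~-trans (~-+ (·~·% (2·s~𝟎 klein-quotient) i) (·~·% 2·t~𝟎 j)) (klein-rep (i % 2) (j % 2) (m%n<n i 2) (m%n<n j 2))
  label {cyclic} cyclic-quotient i j = ~-trans i·s+j·t~[i+2j]·s
    (~-trans (·~·% (4·s~𝟎 cyclic-quotient) (i + 2 * j)) (cyclic-rep 2·s~t′ _ (m%n<n (i + 2 * j) 4)))
    where
    2·s~t′ = 2·s~t cyclic-quotient
    i·s+j·t~[i+2j]·s : i · s +ᵥ j · t ~ (i + 2 * j) · s
    i·s+j·t~[i+2j]·s = ~-trans (~-+ (~-refl {x = i · s}) (~-sym (~-· j 2·s~t′)))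
      (≡⇒~ (trans (cong (i · s +ᵥ_) (trans (sym (·-* j 2 s)) (cong (_· s) (ℕ.*-comm j 2)))) (sym (·-+ i (2 * j) s))))

  Cη⇔ : ∀ {q} → IsQuotType m n C₀ q → ∀ i j c → Cᵢ m n C₀ s t (η q i j) c ⇔ c ~ i · s +ᵥ j · t
  Cη⇔ {q} quotient i j c = mk⇔ (λ p → ~-trans (to (Cᵢ⇔~rep _ (η<4 q i j) c) p) (~-sym (label quotient i j)))
                               (λ p → from (Cᵢ⇔~rep _ (η<4 q i j) c) (~-trans p (label quotient i j)))

  o·s~𝟎 : ∀ {q o} → IsQuotType m n C₀ q → (q ≡ klein → 2 ∣ o) → (q ≡ cyclic → 4 ∣ o) → o · s ~ 𝟎 n
  o·s~𝟎 {klein}  klein-quotient  2∣o _   = ·~𝟎⇒∣⇒·~𝟎 (2·s~𝟎 klein-quotient) (2∣o refl)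
  o·s~𝟎 {cyclic} cyclic-quotient _   4∣o = ·~𝟎⇒∣⇒·~𝟎 (4·s~𝟎 cyclic-quotient) (4∣o refl)

  o·t~𝟎 : ∀ {o} → 2 ∣ o → o · t ~ 𝟎 n
  o·t~𝟎 = ·~𝟎⇒∣⇒·~𝟎 2·t~𝟎

  dot-~ˡ : ∀ {c r w} → c ~ r → Dual m n C₀ w → ⟨ c , w ⟩ ≡ ⟨ r , w ⟩
  dot-~ˡ {c} {r} {w} c~r w∈C₀⊥ = begin
    ⟨ c , w ⟩                     ≡⟨ cong ⟨_, w ⟩ (x+[y-x]≡y r c) ⟨
    ⟨ r +ᵥ (c +ᵥ -ᵥ r) , w ⟩      ≡⟨ dot-+ˡ r _ w ⟩
    ⟨ r , w ⟩ ⊕ ⟨ c +ᵥ -ᵥ r , w ⟩  ≡⟨ cong (⟨ r , w ⟩ ⊕_) (w∈C₀⊥ _ c~r) ⟩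
    ⟨ r , w ⟩ ⊕ 𝟘                 ≡⟨ Zm.+-identityʳ _ ⟩
    ⟨ r , w ⟩                     ∎
    where open ≡-Reasoning

  dot-~ : ∀ {c c′ r r′} → Dual m n C₀ r → Dual m n C₀ r′ → c ~ r → c′ ~ r′ → ⟨ c , c′ ⟩ ≡ ⟨ r , r′ ⟩
  dot-~ {c} {c′} {r} {r′} r∈C₀⊥ r′∈C₀⊥ c~r c′~r′ = begin
    ⟨ c , c′ ⟩  ≡⟨ dot-~ˡ c~r (Dual-~ c′~r′ r′∈C₀⊥) ⟩
    ⟨ r , c′ ⟩  ≡⟨ dot-comm r c′ ⟩
    ⟨ c′ , r ⟩  ≡⟨ dot-~ˡ c′~r′ r∈C₀⊥ ⟩
    ⟨ r′ , r ⟩  ≡⟨ dot-comm r′ r ⟩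
    ⟨ r , r′ ⟩  ∎
    where open ≡-Reasoning

  ⟨t,s⟩≢𝟘 : ¬ ⟨ t , s ⟩ ≡ 𝟘
  ⟨t,s⟩≢𝟘 ⟨t,s⟩≡𝟘 = s∉C (from (sdC s) s∈C⊥)
    where
    s∈C⊥ : Dual m n C s
    s∈C⊥ u u∈C with C-cover u u∈C
    ... | inj₁ u~𝟎 = s∈C₀⊥ u (~𝟎⇒∈ u~𝟎)
    ... | inj₂ u~t = trans (dot-~ˡ u~t s∈C₀⊥) ⟨t,s⟩≡𝟘

  m≡1⇒¬cyclic : m ≡ 1 → ¬ IsQuotType m n C₀ cyclic
  m≡1⇒¬cyclic m≡1 (x , _ , x+x∉C₀) = x+x∉C₀ (subst C₀ (trans (sym (m≡1⇒2·≡𝟎 m≡1 x)) (2·≡+ᵥ x)) C-𝟎)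

module Extension {m n} (C C₀ : Code m n) (isC : IsCode m n C) (sdC : SelfDual m n C)
  (isC₀ : IsCode m n C₀) (C₀⊆C : Subcode m n C₀ C) {a b} (sizeC₀ : HasSize m n C₀ a) (sizeC : HasSize m n C b)
  (b≡2a : b ≡ 2 * a) {t s} (t∈C : C t) (t∉C₀ : ¬ C₀ t) (s∈C₀⊥ : Dual m n C₀ s) (s∉C : ¬ C s)
  {q} (quotient : IsQuotType m n C₀ q) {k} (v₁ v₂ : Word m k) {o₁ o₂} (ord₁ : IsOrder m v₁ o₁) (ord₂ : IsOrder m v₂ o₂)
  (P1 : ∀ (α β : ℕ) → α < o₁ → β < o₂ → addW m (scaleW m α v₁) (scaleW m β v₂) ≡ zeroW m k → α ≡ 0 × β ≡ 0)
  (P2₁₁ : dot m v₁ v₁ ≡ negₘ m (dot m s s)) (P2₁₂ : dot m v₁ v₂ ≡ negₘ m (dot m t s))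
  (P2₂₂ : dot m v₂ v₂ ≡ negₘ m (dot m t t)) where

  open Words m
  open CodeProperties m C₀ isC₀
  open IndexTwo {m} C C₀ isC sdC isC₀ C₀⊆C sizeC₀ sizeC b≡2a t∈C t∉C₀ s∈C₀⊥ s∉C

  ⟨v₁,v₂⟩≢𝟘 : ¬ ⟨ v₁ , v₂ ⟩ ≡ 𝟘
  ⟨v₁,v₂⟩≢𝟘 eq = ⟨t,s⟩≢𝟘 (trans (sym (Zmᴾ.-‿involutive _)) (trans (cong ⊖_ (trans (sym P2₁₂) eq)) Zmᴾ.-0#≈0#))

  -- over ℤ₂ the parity condition (P3) is automatic: v₁, v₂ ≠ 0 have order 2 and C₀⊥/C₀ is a Klein group
  parity-m≡1 : m ≡ 1 → (q ≡ klein → 2 ∣ o₁) × (q ≡ cyclic → 4 ∣ o₁) × 2 ∣ o₂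
  parity-m≡1 m≡1 = (λ _ → subst (2 ∣_) (sym o₁≡2) ∣-refl)
                 , (λ { refl → ⊥-elim (m≡1⇒¬cyclic m≡1 quotient) })
                 , subst (2 ∣_) (sym o₂≡2) ∣-refl
    where
    o₁≡2 = order≡2 ord₁ (λ v₁≡𝟎 → ⟨v₁,v₂⟩≢𝟘 (trans (cong ⟨_, v₂ ⟩ v₁≡𝟎) (dot-𝟎ˡ v₂))) (m≡1⇒2·≡𝟎 m≡1 v₁)
    o₂≡2 = order≡2 ord₂ (λ v₂≡𝟎 → ⟨v₁,v₂⟩≢𝟘 (trans (dot-comm v₁ v₂) (trans (cong ⟨_, v₁ ⟩ v₂≡𝟎) (dot-𝟎ˡ v₁)))) (m≡1⇒2·≡𝟎 m≡1 v₂)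

  o₁·v₁≡𝟎 : o₁ · v₁ ≡ 𝟎 k
  o₁·v₁≡𝟎 = proj₁ (proj₂ ord₁)

  o₂·v₂≡𝟎 : o₂ · v₂ ≡ 𝟎 k
  o₂·v₂≡𝟎 = proj₁ (proj₂ ord₂)

  instance
    o₁-nonZero : NonZero o₁
    o₁-nonZero = ℕ.>-nonZero (proj₁ ord₁)
    o₂-nonZero : NonZero o₂
    o₂-nonZero = ℕ.>-nonZero (proj₁ ord₂)

  Ψ : ℕ → ℕ → Word m n → Word m (k + n)
  Ψ i j x = lin v₁ v₂ i j ++ lin s t i j +ᵥ x

  Ψ-+ : ∀ i j x i′ j′ x′ → Ψ i j x +ᵥ Ψ i′ j′ x′ ≡ Ψ (i + i′) (j + j′) (x +ᵥ x′)
  Ψ-+ i j x i′ j′ x′ = trans (+ᵥ-++ (lin v₁ v₂ i j) _ (lin v₁ v₂ i′ j′) _)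
    (cong₂ _++_ (sym (lin-+ v₁ v₂ i j i′ j′))
      (trans (W⁺.interchange (lin s t i j) x (lin s t i′ j′) x′) (cong (_+ᵥ (x +ᵥ x′)) (sym (lin-+ s t i j i′ j′)))))

  Ψ-· : ∀ c i j x → c · Ψ i j x ≡ Ψ (c * i) (c * j) (c · x)
  Ψ-· c i j x = trans (·-++ c (lin v₁ v₂ i j) _)
    (cong₂ _++_ (lin-· v₁ v₂ c i j) (trans (·-distrib c (lin s t i j) x) (cong (_+ᵥ c · x) (lin-· s t c i j))))

  Ψ-absorb : ∀ i j i′ j′ x → lin v₁ v₂ i′ j′ ≡ 𝟎 k → Ψ (i + i′) (j + j′) x ≡ Ψ i j (x +ᵥ lin s t i′ j′)
  Ψ-absorb i j i′ j′ x i′v₁+j′v₂≡𝟎 = cong₂ _++_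
    (trans (lin-+ v₁ v₂ i j i′ j′) (trans (cong (lin v₁ v₂ i j +ᵥ_) i′v₁+j′v₂≡𝟎) (W.identityʳ _)))
    (trans (cong (_+ᵥ x) (lin-+ s t i j i′ j′)) (trans (W.assoc (lin s t i j) _ x) (cong (lin s t i j +ᵥ_) (W.comm _ x))))

  Ψ-0-0 : ∀ x → Ψ 0 0 x ≡ 𝟎 k ++ x
  Ψ-0-0 x = cong₂ _++_ (lin-0-0 v₁ v₂) (trans (cong (_+ᵥ x) (lin-0-0 s t)) (W.identityˡ x))

  Ψ-1-0 : ∀ x → Ψ 1 0 x ≡ v₁ ++ s +ᵥ x
  Ψ-1-0 x = cong₂ _++_ (lin-1-0 v₁ v₂) (cong (_+ᵥ x) (lin-1-0 s t))

  Ψ-0-1 : ∀ x → Ψ 0 1 x ≡ v₂ ++ t +ᵥ x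
  Ψ-0-1 x = cong₂ _++_ (lin-0-1 v₁ v₂) (cong (_+ᵥ x) (lin-0-1 s t))

  C* : Code m (k + n)
  C* = CStar m k n C₀ s t v₁ v₂

  C*-isCode : IsCode m (k + n) C*
  C*-isCode = SpanProperties.Span-isCode m

  module C*ᴾ = CodeProperties m C* C*-isCode

  Image : Word m (k + n) → Set
  Image w = Σ ℕ λ i → Σ ℕ λ j → Σ (Word m n) λ x → C₀ x × w ≡ Ψ i j x

  C*⊆Image : ∀ {w} → C* w → Image w
  C*⊆Image (gen (inj₁ (c , c~s , refl))) = 1 , 0 , c +ᵥ -ᵥ s , c~s , sym (trans (Ψ-1-0 _) (cong (v₁ ++_) (x+[y-x]≡y s c)))
  C*⊆Image (gen (inj₂ (c , c~t , refl))) = 0 , 1 , c +ᵥ -ᵥ t , c~t , sym (trans (Ψ-0-1 _) (cong (v₂ ++_) (x+[y-x]≡y t c)))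
  C*⊆Image zer = 0 , 0 , 𝟎 n , C-𝟎 , trans (𝟎-++ k n) (sym (Ψ-0-0 (𝟎 n)))
  C*⊆Image (plus p p′) with C*⊆Image p | C*⊆Image p′
  ... | i , j , x , x∈C₀ , refl | i′ , j′ , x′ , x′∈C₀ , refl = i + i′ , j + j′ , x +ᵥ x′ , C-+ x∈C₀ x′∈C₀ , Ψ-+ i j x i′ j′ x′
  C*⊆Image (neg p) with C*⊆Image p
  ... | i , j , x , x∈C₀ , refl =
    (M ∸ 1) * i , (M ∸ 1) * j , (M ∸ 1) · x , C-· (M ∸ 1) x∈C₀ , trans (-ᵥ≡[M∸1]· _) (Ψ-· (M ∸ 1) i j x)

  Ψ-0-0∈C* : ∀ {x} → C₀ x → C* (Ψ 0 0 x)
  Ψ-0-0∈C* {x} x∈C₀ = subst C* difference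
    (plus (gen (inj₁ (s +ᵥ x , subst C₀ (sym ([x+y]-x≡y s x)) x∈C₀ , refl))) (neg (gen (inj₁ (s , ~-refl , refl)))))
    where
    open ≡-Reasoning
    difference : (v₁ ++ s +ᵥ x) +ᵥ -ᵥ (v₁ ++ s) ≡ Ψ 0 0 x
    difference = begin
      (v₁ ++ s +ᵥ x) +ᵥ -ᵥ (v₁ ++ s)             ≡⟨ cong ((v₁ ++ s +ᵥ x) +ᵥ_) (Vec.map-++ (negₘ m) v₁ s) ⟩
      (v₁ ++ s +ᵥ x) +ᵥ (-ᵥ v₁ ++ -ᵥ s)          ≡⟨ +ᵥ-++ v₁ _ (-ᵥ v₁) _ ⟩
      (v₁ +ᵥ -ᵥ v₁) ++ ((s +ᵥ x) +ᵥ -ᵥ s)       ≡⟨ cong₂ _++_ (W.inverseʳ v₁) ([x+y]-x≡y s x) ⟩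
      𝟎 k ++ x                                  ≡⟨ Ψ-0-0 x ⟨
      Ψ 0 0 x                                   ∎

  Image⊆C* : ∀ {w} → Image w → C* w
  Image⊆C* (i , j , x , x∈C₀ , refl) = subst C* combination
    (C*ᴾ.C-+ (C*ᴾ.C-+ (C*ᴾ.C-· i G₁∈C*) (C*ᴾ.C-· j G₂∈C*)) (Ψ-0-0∈C* x∈C₀))
    where
    G₁∈C* : C* (Ψ 1 0 (𝟎 n))
    G₁∈C* = gen (inj₁ (s +ᵥ 𝟎 n , subst C₀ (sym ([x+y]-x≡y s (𝟎 n))) C-𝟎 , Ψ-1-0 (𝟎 n)))
    G₂∈C* : C* (Ψ 0 1 (𝟎 n))
    G₂∈C* = gen (inj₂ (t +ᵥ 𝟎 n , subst C₀ (sym ([x+y]-x≡y t (𝟎 n))) C-𝟎 , Ψ-0-1 (𝟎 n)))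
    open ≡-Reasoning
    open +-*-Solver using (solve; _:+_; _:*_; con; _:=_)
    combination : i · Ψ 1 0 (𝟎 n) +ᵥ j · Ψ 0 1 (𝟎 n) +ᵥ Ψ 0 0 x ≡ Ψ i j x
    combination = begin
      i · Ψ 1 0 (𝟎 n) +ᵥ j · Ψ 0 1 (𝟎 n) +ᵥ Ψ 0 0 x
        ≡⟨ cong₂ (λ u v → u +ᵥ v +ᵥ Ψ 0 0 x) (Ψ-· i 1 0 (𝟎 n)) (Ψ-· j 0 1 (𝟎 n)) ⟩
      Ψ (i * 1) (i * 0) (i · 𝟎 n) +ᵥ Ψ (j * 0) (j * 1) (j · 𝟎 n) +ᵥ Ψ 0 0 x
        ≡⟨ cong (_+ᵥ Ψ 0 0 x) (Ψ-+ _ _ _ _ _ _) ⟩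
      Ψ (i * 1 + j * 0) (i * 0 + j * 1) (i · 𝟎 n +ᵥ j · 𝟎 n) +ᵥ Ψ 0 0 x
        ≡⟨ Ψ-+ _ _ _ _ _ _ ⟩
      Ψ (i * 1 + j * 0 + 0) (i * 0 + j * 1 + 0) (i · 𝟎 n +ᵥ j · 𝟎 n +ᵥ x)
        ≡⟨ cong₂ (λ u v → Ψ u v (i · 𝟎 n +ᵥ j · 𝟎 n +ᵥ x)) (solve 2 (λ i j → i :* con 1 :+ j :* con 0 :+ con 0 := i) refl i j)
                                     (solve 2 (λ i j → i :* con 0 :+ j :* con 1 :+ con 0 := j) refl i j) ⟩
      Ψ i j (i · 𝟎 n +ᵥ j · 𝟎 n +ᵥ x)
        ≡⟨ cong (Ψ i j) (trans (cong₂ (λ u v → u +ᵥ v +ᵥ x) (·𝟎 n i) (·𝟎 n j))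
                                (trans (cong (_+ᵥ x) (W.identityˡ _)) (W.identityˡ x))) ⟩
      Ψ i j x ∎

  C*-selfOrthogonal : SelfOrthogonal m (k + n) C*
  C*-selfOrthogonal = SpanProperties.Span-selfOrthogonal m generators-orthogonal
    where
    orthogonal-pair : ∀ v v′ r r′ {c c′} → ⟨ v , v′ ⟩ ≡ ⊖ ⟨ r , r′ ⟩ → Dual m n C₀ r → Dual m n C₀ r′ →
                      c ~ r → c′ ~ r′ → ⟨ v ++ c , v′ ++ c′ ⟩ ≡ 𝟘
    orthogonal-pair v v′ r r′ {c} {c′} ⟨v,v′⟩≡ r∈C₀⊥ r′∈C₀⊥ c~r c′~r′ =
      trans (dot-++ v v′ c c′) (trans (cong₂ _⊕_ ⟨v,v′⟩≡ (dot-~ r∈C₀⊥ r′∈C₀⊥ c~r c′~r′)) (Zm.-‿inverseˡ _))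
    generators-orthogonal : ∀ u v → GenStar m k n C₀ s t v₁ v₂ u → GenStar m k n C₀ s t v₁ v₂ v → ⟨ u , v ⟩ ≡ 𝟘
    generators-orthogonal _ _ (inj₁ (c , c~s , refl)) (inj₁ (c′ , c′~s , refl)) =
      orthogonal-pair v₁ v₁ s s P2₁₁ s∈C₀⊥ s∈C₀⊥ c~s c′~s
    generators-orthogonal _ _ (inj₁ (c , c~s , refl)) (inj₂ (c′ , c′~t , refl)) =
      orthogonal-pair v₁ v₂ s t (trans P2₁₂ (cong ⊖_ (dot-comm t s))) s∈C₀⊥ t∈C₀⊥ c~s c′~t
    generators-orthogonal _ _ (inj₂ (c , c~t , refl)) (inj₁ (c′ , c′~s , refl)) =
      orthogonal-pair v₂ v₁ t s (trans (dot-comm v₂ v₁) P2₁₂) t∈C₀⊥ s∈C₀⊥ c~t c′~s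
    generators-orthogonal _ _ (inj₂ (c , c~t , refl)) (inj₂ (c′ , c′~t , refl)) =
      orthogonal-pair v₂ v₂ t t P2₂₂ t∈C₀⊥ t∈C₀⊥ c~t c′~t

  lin-v≡𝟎 : ∀ {α β} → o₁ ∣ α → o₂ ∣ β → lin v₁ v₂ α β ≡ 𝟎 k
  lin-v≡𝟎 (divides e refl) (divides e′ refl) = trans (cong₂ _+ᵥ_ (vanish e v₁ o₁·v₁≡𝟎) (vanish e′ v₂ o₂·v₂≡𝟎)) (W.identityˡ (𝟎 k))
    where
    vanish : ∀ e {o} v → o · v ≡ 𝟎 k → (e * o) · v ≡ 𝟎 k
    vanish e {o} v o·v≡𝟎 = trans (·-* e o v) (trans (cong (e ·_) o·v≡𝟎) (·𝟎 k e))

  lin-v≡𝟎⇒∣ : ∀ α β → lin v₁ v₂ α β ≡ 𝟎 k → o₁ ∣ α × o₂ ∣ β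
  lin-v≡𝟎⇒∣ α β eq with P1 (α % o₁) (β % o₂) (m%n<n α o₁) (m%n<n β o₂)
                         (trans (sym (cong₂ _+ᵥ_ (·≡·% o₁·v₁≡𝟎 α) (·≡·% o₂·v₂≡𝟎 β))) eq)
  ... | α%o₁≡0 , β%o₂≡0 = m%n≡0⇒n∣m α o₁ α%o₁≡0 , m%n≡0⇒n∣m β o₂ β%o₂≡0

  lin-v-injective : ∀ {i i′ j j′} → i < o₁ → i′ < o₁ → j < o₂ → j′ < o₂ →
                    lin v₁ v₂ (suc i) (suc j) ≡ lin v₁ v₂ (suc i′) (suc j′) → i ≡ i′ × j ≡ j′
  lin-v-injective {i} {i′} {j} {j′} i<o₁ i′<o₁ j<o₂ j′<o₂ eq with lin-v≡𝟎⇒∣ _ _ complement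
    where
    open ≡-Reasoning
    complement : lin v₁ v₂ (suc i + (o₁ ∸ suc i′)) (suc j + (o₂ ∸ suc j′)) ≡ 𝟎 k
    complement = begin
      lin v₁ v₂ (suc i + (o₁ ∸ suc i′)) (suc j + (o₂ ∸ suc j′))
        ≡⟨ lin-+ v₁ v₂ (suc i) (suc j) _ _ ⟩
      lin v₁ v₂ (suc i) (suc j) +ᵥ lin v₁ v₂ (o₁ ∸ suc i′) (o₂ ∸ suc j′)
        ≡⟨ cong (_+ᵥ lin v₁ v₂ (o₁ ∸ suc i′) (o₂ ∸ suc j′)) eq ⟩
      lin v₁ v₂ (suc i′) (suc j′) +ᵥ lin v₁ v₂ (o₁ ∸ suc i′) (o₂ ∸ suc j′)
        ≡⟨ lin-+ v₁ v₂ (suc i′) (suc j′) _ _ ⟨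
      lin v₁ v₂ (suc i′ + (o₁ ∸ suc i′)) (suc j′ + (o₂ ∸ suc j′))
        ≡⟨ cong₂ (lin v₁ v₂) (ℕ.m+[n∸m]≡n i′<o₁) (ℕ.m+[n∸m]≡n j′<o₂) ⟩
      lin v₁ v₂ o₁ o₂
        ≡⟨ lin-v≡𝟎 ∣-refl ∣-refl ⟩
      𝟎 k ∎
  ... | o₁∣ , o₂∣ = ∣suc+[∸suc]⇒≡ i<o₁ i′<o₁ o₁∣ , ∣suc+[∸suc]⇒≡ j<o₂ j′<o₂ o₂∣

  embed : Fin o₁ × Fin o₂ → Word m n → Word m (k + n)
  embed (i , j) x = Ψ (suc (toℕ i)) (suc (toℕ j)) x

  embed-injective : ∀ {p p′ x x′} → embed p x ≡ embed p′ x′ → p ≡ p′ × x ≡ x′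
  embed-injective {i , j} {i′ , j′} {x} {x′} eq =
    cong₂ _,_ (Fin.toℕ-injective i≡i′) (Fin.toℕ-injective j≡j′) , Wᴾ.∙-cancelˡ _ x x′ tails
    where
    halves = Vec.++-injective (lin v₁ v₂ (suc (toℕ i)) (suc (toℕ j))) (lin v₁ v₂ (suc (toℕ i′)) (suc (toℕ j′))) eq
    indices = lin-v-injective (Fin.toℕ<n i) (Fin.toℕ<n i′) (Fin.toℕ<n j) (Fin.toℕ<n j′) (proj₁ halves)
    i≡i′ = proj₁ indices
    j≡j′ = proj₂ indices
    tails : lin s t (suc (toℕ i)) (suc (toℕ j)) +ᵥ x ≡ lin s t (suc (toℕ i)) (suc (toℕ j)) +ᵥ x′
    tails = trans (proj₂ halves) (cong₂ (λ u v → lin s t (suc u) (suc v) +ᵥ x′) (sym i≡i′) (sym j≡j′))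

  2*|C*|≡o₁*o₂*|C| : 2 * (o₁ * o₂ * a) ≡ o₁ * o₂ * b
  2*|C*|≡o₁*o₂*|C| = begin
    2 * (o₁ * o₂ * a)  ≡⟨ ℕ.*-comm 2 (o₁ * o₂ * a) ⟩
    o₁ * o₂ * a * 2    ≡⟨ ℕ.*-assoc (o₁ * o₂) a 2 ⟩
    o₁ * o₂ * (a * 2)  ≡⟨ cong (o₁ * o₂ *_) (trans (ℕ.*-comm a 2) (sym b≡2a)) ⟩
    o₁ * o₂ * b        ∎
    where open ≡-Reasoning

  |C*|≡2^ : o₁ * o₂ * a ≡ o₁ * o₂ * 2 ^ (m * n / 2 ∸ 1)
  |C*|≡2^ = cong (o₁ * o₂ *_) a≡2^

  module WithParity (parity : (q ≡ klein → 2 ∣ o₁) × (q ≡ cyclic → 4 ∣ o₁) × 2 ∣ o₂) where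

    lin-st∈C₀ : ∀ {α β} → o₁ ∣ α → o₂ ∣ β → C₀ (lin s t α β)
    lin-st∈C₀ o₁∣α o₂∣β = C-+ (~𝟎⇒∈ (·~𝟎⇒∣⇒·~𝟎 o₁·s~𝟎 o₁∣α)) (~𝟎⇒∈ (·~𝟎⇒∣⇒·~𝟎 (o·t~𝟎 (proj₂ (proj₂ parity))) o₂∣β))
      where o₁·s~𝟎 = o·s~𝟎 quotient (proj₁ parity) (proj₁ (proj₂ parity))

    Normal : Word m (k + n) → Set
    Normal w = Σ ℕ λ i → Σ ℕ λ j → 1 ≤ i × i ≤ o₁ × 1 ≤ j × j ≤ o₂ × Σ (Word m n) λ x → C₀ x × w ≡ Ψ i j x

    normalise : ∀ {w} → Image w → Normal w
    normalise (i , j , x , x∈C₀ , refl) with positive-residue o₁ i | positive-residue o₂ j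
    ... | i′ , c , 1≤i′ , i′≤o₁ , i+o₁≡ | j′ , c′ , 1≤j′ , j′≤o₂ , j+o₂≡ =
      i′ , j′ , 1≤i′ , i′≤o₁ , 1≤j′ , j′≤o₂ , y +ᵥ lin s t (c * o₁) (c′ * o₂) ,
      C-+ y∈C₀ (lin-st∈C₀ (n∣m*n c) (n∣m*n c′)) , shift
      where
      L = lin s t o₁ o₂
      y = x +ᵥ -ᵥ L
      y∈C₀ = C-+ x∈C₀ (C-neg (lin-st∈C₀ ∣-refl ∣-refl))
      open ≡-Reasoning
      shift : Ψ i j x ≡ Ψ i′ j′ (y +ᵥ lin s t (c * o₁) (c′ * o₂))
      shift = begin
        Ψ i j x                                    ≡⟨ cong (Ψ i j) (Wᴾ.//-rightDividesˡ L x) ⟨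
        Ψ i j (y +ᵥ L)                             ≡⟨ Ψ-absorb i j o₁ o₂ y (lin-v≡𝟎 ∣-refl ∣-refl) ⟨
        Ψ (i + o₁) (j + o₂) y                      ≡⟨ cong₂ (λ u v → Ψ u v y) i+o₁≡ j+o₂≡ ⟩
        Ψ (i′ + c * o₁) (j′ + c′ * o₂) y           ≡⟨ Ψ-absorb i′ j′ _ _ y (lin-v≡𝟎 (n∣m*n c) (n∣m*n c′)) ⟩
        Ψ i′ j′ (y +ᵥ lin s t (c * o₁) (c′ * o₂))  ∎

    RHS : Word m (k + n) → Set
    RHS w = Σ ℕ λ i → Σ ℕ λ j →
            1 ≤ i × i ≤ o₁ × 1 ≤ j × j ≤ o₂ ×
            Σ (Word m n) λ c → Cᵢ m n C₀ s t (η q i j) c × w ≡ addW m (scaleW m i v₁) (scaleW m j v₂) ++ c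

    Normal⇔RHS : ∀ w → Normal w ⇔ RHS w
    Normal⇔RHS w = mk⇔
      (λ (i , j , 1≤i , i≤o₁ , 1≤j , j≤o₂ , x , x∈C₀ , eq) → i , j , 1≤i , i≤o₁ , 1≤j , j≤o₂ , lin s t i j +ᵥ x ,
         from (Cη⇔ quotient i j _) (subst C₀ (sym ([x+y]-x≡y (lin s t i j) x)) x∈C₀) , eq)
      (λ (i , j , 1≤i , i≤o₁ , 1≤j , j≤o₂ , c , c∈Cη , eq) → i , j , 1≤i , i≤o₁ , 1≤j , j≤o₂ , c +ᵥ -ᵥ lin s t i j ,
         to (Cη⇔ quotient i j c) c∈Cη ,
         trans eq (cong (lin v₁ v₂ i j ++_) (sym (x+[y-x]≡y (lin s t i j) c))))

    C*⇔RHS : ∀ w → C* w ⇔ RHS w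
    C*⇔RHS w = mk⇔ (to (Normal⇔RHS w) ∘ normalise ∘ C*⊆Image)
                   (λ r → let (i , j , _ , _ , _ , _ , x , x∈C₀ , eq) = from (Normal⇔RHS w) r in Image⊆C* (i , j , x , x∈C₀ , eq))

    C*-size : HasSize m (k + n) C* (o₁ * o₂ * a)
    C*-size = size-resp equiv (size-product embed embed-injective pairs sizeC₀)
      where
      pairs = size-product _,_ (λ { refl → refl , refl }) (size-Fin o₁) (size-Fin o₂)
      Pairs : Fin o₁ × Fin o₂ → Set
      Pairs p = Σ (Fin o₁) λ i → Σ (Fin o₂) λ j → ⊤ × ⊤ × p ≡ (i , j)
      unembed : ∀ {w} → Normal w → Σ (Fin o₁ × Fin o₂) λ p → Σ (Word m n) λ x → Pairs p × C₀ x × w ≡ embed p x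
      unembed (suc i , suc j , _ , i<o₁ , _ , j<o₂ , x , x∈C₀ , eq) =
        (fromℕ< i<o₁ , fromℕ< j<o₂) , x , (_ , _ , tt , tt , refl) , x∈C₀ ,
        trans eq (cong₂ (λ u v → Ψ (suc u) (suc v) x) (sym (Fin.toℕ-fromℕ< i<o₁)) (sym (Fin.toℕ-fromℕ< j<o₂)))
      equiv : ∀ w → (Σ (Fin o₁ × Fin o₂) λ p → Σ (Word m n) λ x → Pairs p × C₀ x × w ≡ embed p x) ⇔ C* w
      equiv w = mk⇔ (λ { ((i , j) , x , _ , x∈C₀ , eq) → Image⊆C* (suc (toℕ i) , suc (toℕ j) , x , x∈C₀ , eq) })
                    (unembed ∘ normalise ∘ C*⊆Image)

proposition3p1 :
    ∀ (m n : ℕ) → 1 ≤ m →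
    (C C₀ : Code m n) →
    IsCode m n C → SelfDual m n C →
    IsCode m n C₀ → Subcode m n C₀ C →
    -- C₀ ⊆ C with |C₀| = a, |C| = b, index 2 in C
    (a b : ℕ) → HasSize m n C₀ a → HasSize m n C b → b ≡ 2 * a →
    (t s : Word m n) →
    C t → ¬ C₀ t →
    Dual m n C₀ s → ¬ C s →
    -- the isomorphism type of C₀^⊥ / C₀
    (q : QuotType) → IsQuotType m n C₀ q →
    (k : ℕ) → 1 ≤ k →
    (v₁ v₂ : Word m k) →
    (o₁ o₂ : ℕ) → IsOrder m v₁ o₁ → IsOrder m v₂ o₂ →
    -- (P1)
    (∀ (α β : ℕ) → α < o₁ → β < o₂ →
       addW m (scaleW m α v₁) (scaleW m β v₂) ≡ zeroW m k →
       α ≡ 0 × β ≡ 0) →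
    -- (P2)
    dot m v₁ v₁ ≡ negₘ m (dot m s s) →
    dot m v₁ v₂ ≡ negₘ m (dot m t s) →
    dot m v₂ v₂ ≡ negₘ m (dot m t t) →
    -- (P3)
    (2 ≤ m →
       (q ≡ klein → 2 ∣ o₁) × (q ≡ cyclic → 4 ∣ o₁) × 2 ∣ o₂) →
    -- conclusions
    (∀ w → CStar m k n C₀ s t v₁ v₂ w ⇔
       Σ ℕ λ i → Σ ℕ λ j →
         1 ≤ i × i ≤ o₁ × 1 ≤ j × j ≤ o₂ ×
         Σ (Word m n) λ c → Cᵢ m n C₀ s t (η q i j) c ×
           w ≡ addW m (scaleW m i v₁) (scaleW m j v₂) ++ c)
    × IsCode m (k + n) (CStar m k n C₀ s t v₁ v₂)
    × SelfOrthogonal m (k + n) (CStar m k n C₀ s t v₁ v₂)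
    × HasSize m (k + n) (CStar m k n C₀ s t v₁ v₂) (o₁ * o₂ * a)
    × 2 * (o₁ * o₂ * a) ≡ o₁ * o₂ * b
    × o₁ * o₂ * a ≡ o₁ * o₂ * 2 ^ (m * n / 2 ∸ 1)
proposition3p1 m n 1≤m C C₀ isC sdC isC₀ C₀⊆C a b sizeC₀ sizeC b≡2a t s t∈C t∉C₀ s∈C₀⊥ s∉C
               q quotient k _ v₁ v₂ o₁ o₂ ord₁ ord₂ P1 P2₁₁ P2₁₂ P2₂₂ P3 =
  C*⇔RHS , C*-isCode , C*-selfOrthogonal , C*-size , 2*|C*|≡o₁*o₂*|C| , |C*|≡2^
  where
  open Extension {m} C C₀ isC sdC isC₀ C₀⊆C sizeC₀ sizeC b≡2a t∈C t∉C₀ s∈C₀⊥ s∉C quotient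
                 v₁ v₂ ord₁ ord₂ P1 P2₁₁ P2₁₂ P2₂₂
  open WithParity ([ P3 , parity-m≡1 ∘ sym ]′ (ℕ.m≤n⇒m<n∨m≡n 1≤m))
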